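{- For every integer $n\geq 10$ with $n\equiv 1 \pmod 3$, there exists a graph of order $n$ with exactly $2n-5$ edges and maximum degree $(n-1)/3$ which is both hypohamiltonian and $K_2$-hamiltonian.
   Context: All graphs are finite, simple and connected. A graph is hamiltonian if it has a cycle through all its vertices. A graph is hypohamiltonian if it is not hamiltonian but $G-v$ is hamiltonian for every vertex $v$. A graph $G$ is $K_2$-hamiltonian if for every pair of adjacent vertices $u,v$ the graph $G-u-v$ is hamiltonian. -}

module Defs where

open import Data.Nat using (ℕ; zero; suc; _+_; _<_; _≤_; _∸_)
open import Data.Fin using (Fin; toℕ)
open import Data.Bool using (Bool; true; false; _≟_)
open import Data.List using (List; []; _∷_; length; filter; allFin; map; concatMap)
open import Data.List.Membership.Propositional using (_∈_)
open import Data.List.Relation.Unary.Unique.Propositional using (Unique)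
open import Data.Product using (Σ; _×_; _,_; ∃)
open import Relation.Binary.PropositionalEquality using (_≡_)
open import Relation.Nullary using (¬_)
open import Relation.Nullary.Decidable using (does)
open import Data.Nat.Properties using (_<?_)

record Graph (n : ℕ) : Set where
  field
    adj   : Fin n → Fin n → Bool
    sym   : ∀ u v → adj u v ≡ adj v u
    irrefl : ∀ v → adj v v ≡ false
open Graph public

Adj : ∀ {n} → Graph n → Fin n → Fin n → Set
Adj G u v = adj G u v ≡ true

neighbours : ∀ {n} → Graph n → Fin n → List (Fin n)
neighbours G v = filter (λ u → adj G v u ≟ true) (allFin _)

degree : ∀ {n} → Graph n → Fin n → ℕ
degree G v = length (neighbours G v)

edgeList : ∀ {n} → Graph n → List (Fin n × Fin n)
edgeList {n} G =
  concatMap (λ u → map (λ v → (u , v))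
    (filter (λ v → toℕ u <? toℕ v) (neighbours G u))) (allFin n)

edgeCount : ∀ {n} → Graph n → ℕ
edgeCount G = length (edgeList G)

MaxDegree : ∀ {n} → Graph n → ℕ → Set
MaxDegree {n} G d = (∀ v → degree G v ≤ d) × ∃ λ v → degree G v ≡ d

data Path {n} (G : Graph n) : List (Fin n) → Set where
  single : ∀ v → Path G (v ∷ [])
  cons   : ∀ u v vs → Adj G u v → Path G (v ∷ vs) → Path G (u ∷ v ∷ vs)

Connected : ∀ {n} → Graph n → Set
Connected {n} G = ∀ (u v : Fin n) → Σ (List (Fin n)) λ vs →
  Path G (u ∷ vs) × lastOr u vs ≡ v
  where
  lastOr : Fin n → List (Fin n) → Fin n
  lastOr x [] = x
  lastOr x (y ∷ ys) = lastOr y ys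

-- A Hamiltonian cycle of the subgraph induced on {w | Present w}:
-- a list v₀ v₁ … v_k (k ≥ 2, i.e. at least 3 vertices), pairwise distinct,
-- consecutive vertices adjacent, v_k adjacent to v₀, containing exactly the
-- present vertices.
HamCycleOn : ∀ {n} → Graph n → (Fin n → Set) → Set
HamCycleOn {n} G Present = Σ (Fin n) λ v₀ → Σ (List (Fin n)) λ vs →
    Path G (v₀ ∷ vs)
  × Adj G (lastOr v₀ vs) v₀
  × 2 ≤ length vs
  × Unique (v₀ ∷ vs)
  × (∀ w → w ∈ (v₀ ∷ vs) → Present w)
  × (∀ w → Present w → w ∈ (v₀ ∷ vs))
  where
  lastOr : Fin n → List (Fin n) → Fin n
  lastOr x [] = x
  lastOr x (y ∷ ys) = lastOr y ys

Hamiltonian : ∀ {n} → Graph n → Set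
Hamiltonian {n} G = HamCycleOn G (λ _ → Data.Unit.⊤)
  where import Data.Unit

HamiltonianMinus : ∀ {n} → Graph n → Fin n → Set
HamiltonianMinus G v = HamCycleOn G (λ w → ¬ (w ≡ v))

HamiltonianMinus2 : ∀ {n} → Graph n → Fin n → Fin n → Set
HamiltonianMinus2 G u v = HamCycleOn G (λ w → ¬ (w ≡ u) × ¬ (w ≡ v))

Hypohamiltonian : ∀ {n} → Graph n → Set
Hypohamiltonian G = ¬ Hamiltonian G × (∀ v → HamiltonianMinus G v)

K2Hamiltonian : ∀ {n} → Graph n → Set
K2Hamiltonian G = ∀ u v → Adj G u v → HamiltonianMinus2 G u v

-- The graph has a rim cycle u₀ … u_{m−1} with m = n − 4 divisible by 3, three hubs a₀, a₁, a₂
-- where uⱼ is joined to a_{j mod 3}, and a centre v joined to the hubs.  It has 2m + 3 = 2n − 5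
-- edges; the hubs have degree m/3 + 1 = (n − 1)/3 and all other vertices degree 3.
--
-- Rotating the rim by one step while cycling the hubs is an automorphism, so hypo- and
-- K₂-hamiltonicity reduce to six explicit cycles: in G − v, G − a₀, G − u₀ and in G minus the
-- ends of the edges a₀v, u₀u₁, u₀a₀.
--
-- A hamiltonian cycle must use the rim edge u_{m−1}u₀: otherwise let u_y u_{y+1} be the first rim
-- edge it misses.  The cycle then runs from u₀ along the rim to u_y and leaves both ends through
-- spokes; in each of the cases y ≡ 0, 1, 2 (mod 3) either this part of the cycle closes up
-- without reaching every vertex, or a hub or the centre gets fewer than two cycle edges.
-- By symmetry the cycle uses every rim edge, so it never leaves the rim.

module Submission where

open import Defs using (Graph; Connected; edgeCount; MaxDegree; Hypohamiltonian; K2Hamiltonian)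
open import Data.Nat using (ℕ; zero; suc; _≤_; _<_; _*_; _+_; _∸_; _%_; _/_; s≤s; z≤n)
open import Data.Nat.Properties using (m+[n∸m]≡n)
open import Data.Nat.DivMod using (m/n≡1+[m∸n]/n)
open import Data.Product using (Σ; _×_; _,_)
open import Relation.Nullary using (Dec; ¬_)
open import Relation.Binary.PropositionalEquality using (_≡_; refl; sym; trans; cong; subst)

module Indices where

  open import Data.Nat
  open import Data.Nat.Properties
  open import Data.List using (List; []; _∷_; length; map)
  open import Data.List.Membership.Propositional using (_∈_)
  open import Data.List.Relation.Unary.Any using (here; there)
  open import Data.List.Relation.Unary.All as All using ([]; _∷_)
  open import Data.List.Relation.Unary.Unique.Propositional using (Unique)
  open import Data.List.Relation.Unary.AllPairs using ([]; _∷_)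
  open import Data.Product using (Σ; _×_; _,_)
  open import Data.Sum using (_⊎_; inj₁; inj₂)
  open import Data.Empty using (⊥-elim)
  open import Relation.Nullary using (¬_; Dec; yes; no)
  open import Relation.Binary.PropositionalEquality

  sucMod : ℕ → ℕ → ℕ
  sucMod N i with suc i <? N
  ... | yes _ = suc i
  ... | no _ = 0

  predMod : ℕ → ℕ → ℕ
  predMod N zero = pred N
  predMod N (suc i) = i

  sucMod< : ∀ N i → i < N → sucMod N i < N
  sucMod< N i i< with suc i <? N
  ... | yes si< = si<
  ... | no _ = ≤-trans (s≤s z≤n) i<

  predMod< : ∀ N i → i < N → predMod N i < N
  predMod< (suc N) zero _ = ≤-refl
  predMod< N (suc i) i< = ≤-trans (n≤1+n (suc i)) i<

  sucMod-predMod : ∀ N i → i < N → sucMod N (predMod N i) ≡ i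
  sucMod-predMod (suc N) zero _ with suc N <? suc N
  ... | yes N< = ⊥-elim (<-irrefl refl N<)
  ... | no _ = refl
  sucMod-predMod N (suc i) i< with suc i <? N
  ... | yes _ = refl
  ... | no ≮ = ⊥-elim (≮ i<)

  predMod-sucMod : ∀ N i → i < N → predMod N (sucMod N i) ≡ i
  predMod-sucMod N i i< with suc i <? N
  ... | yes _ = refl
  predMod-sucMod (suc N) i (s≤s i≤) | no ≮ with m≤n⇒m<n∨m≡n i≤
  ... | inj₁ i<N = ⊥-elim (≮ (s≤s i<N))
  ... | inj₂ i≡N = sym i≡N

  sucMod-cases : ∀ N i → i < N → (suc i < N × sucMod N i ≡ suc i) ⊎ (suc i ≡ N × sucMod N i ≡ 0)
  sucMod-cases N i i< with suc i <? N
  ... | yes si< = inj₁ (si< , refl)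
  ... | no ≮ with m≤n⇒m<n∨m≡n i<
  ... | inj₁ si< = ⊥-elim (≮ si<)
  ... | inj₂ si≡ = inj₂ (si≡ , refl)

  sucMod≢predMod : ∀ N i → 3 ≤ N → i < N → sucMod N i ≢ predMod N i
  sucMod≢predMod (suc (suc (suc N))) zero _ _ ()
  sucMod≢predMod (suc zero) zero (s≤s ()) _ _
  sucMod≢predMod (suc (suc zero)) zero (s≤s (s≤s ())) _ _
  sucMod≢predMod N (suc i) 3≤N i< e with suc (suc i) <? N
  ... | yes _ = ss≢ i e
    where
    ss≢ : ∀ i → suc (suc i) ≢ i
    ss≢ (suc i) e = ss≢ i (suc-injective e)
  sucMod≢predMod N (suc zero) 3≤N i< e | no ≮ = ≮ (≤-trans (s≤s (s≤s (s≤s z≤n))) 3≤N)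
  sucMod≢predMod N (suc (suc i)) 3≤N i< () | no _

  nth : List ℕ → ℕ → ℕ
  nth [] _ = 0
  nth (x ∷ xs) zero = x
  nth (x ∷ xs) (suc i) = nth xs i

  indexOf : ℕ → List ℕ → ℕ
  indexOf w [] = 0
  indexOf w (x ∷ xs) with w ≟ x
  ... | yes _ = 0
  ... | no _ = suc (indexOf w xs)

  nth-indexOf : ∀ {w} L → w ∈ L → nth L (indexOf w L) ≡ w
  nth-indexOf {w} (x ∷ xs) w∈ with w ≟ x
  ... | yes e = sym e
  nth-indexOf {w} (x ∷ xs) (here e) | no w≢x = ⊥-elim (w≢x e)
  nth-indexOf {w} (x ∷ xs) (there w∈) | no _ = nth-indexOf xs w∈

  indexOf< : ∀ {w} L → w ∈ L → indexOf w L < length L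
  indexOf< {w} (x ∷ xs) w∈ with w ≟ x
  ... | yes _ = s≤s z≤n
  indexOf< {w} (x ∷ xs) (here e) | no w≢x = ⊥-elim (w≢x e)
  indexOf< {w} (x ∷ xs) (there w∈) | no _ = s≤s (indexOf< xs w∈)

  nth∈ : ∀ L {i} → i < length L → nth L i ∈ L
  nth∈ (x ∷ xs) {zero} _ = here refl
  nth∈ (x ∷ xs) {suc i} (s≤s i<) = there (nth∈ xs i<)

  nth-injective : ∀ L → Unique L → ∀ {i j} → i < length L → j < length L → nth L i ≡ nth L j → i ≡ j
  nth-injective (x ∷ xs) u {zero} {zero} _ _ _ = refl
  nth-injective (x ∷ xs) (x∉ ∷ _) {zero} {suc j} _ (s≤s j<) e = ⊥-elim (All.lookup x∉ (nth∈ xs j<) e)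
  nth-injective (x ∷ xs) (x∉ ∷ _) {suc i} {zero} (s≤s i<) _ e = ⊥-elim (All.lookup x∉ (nth∈ xs i<) (sym e))
  nth-injective (x ∷ xs) (_ ∷ u) {suc i} {suc j} (s≤s i<) (s≤s j<) e = cong suc (nth-injective xs u i< j< e)

  indexOf-nth : ∀ L → Unique L → ∀ {i} → i < length L → indexOf (nth L i) L ≡ i
  indexOf-nth L u i< = nth-injective L u (indexOf< L (nth∈ L i<)) i< (nth-indexOf L (nth∈ L i<))

  map-nth : ∀ (f : ℕ → ℕ) L {i} → i < length L → nth (map f L) i ≡ f (nth L i)
  map-nth f (x ∷ L) {zero} _ = refl
  map-nth f (x ∷ L) {suc i} (s≤s i<) = map-nth f L i<

  map-indexOf : ∀ (f : ℕ → ℕ) → (∀ {a b} → f a ≡ f b → a ≡ b) → ∀ w L → indexOf (f w) (map f L) ≡ indexOf w L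
  map-indexOf f inj w [] = refl
  map-indexOf f inj w (x ∷ L) with f w ≟ f x | w ≟ x
  ... | yes _ | yes _ = refl
  ... | yes e | no w≢x = ⊥-elim (w≢x (inj e))
  ... | no fw≢fx | yes e = ⊥-elim (fw≢fx (cong f e))
  ... | no _ | no _ = cong suc (map-indexOf f inj w L)

  first-failure : ∀ {Q : ℕ → Set} → (∀ i → Dec (Q i)) → ∀ b → ¬ Q b → Σ ℕ λ y → y ≤ b × ¬ Q y × (∀ i → i < y → Q i)
  first-failure {Q} Q? b ¬Qb = scan b 0 refl (λ _ ())
    where
    scan : ∀ k j → j + k ≡ b → (∀ i → i < j → Q i) → Σ ℕ λ y → y ≤ b × ¬ Q y × (∀ i → i < y → Q i)
    scan k j j+k≡b below with Q? j
    ... | no ¬Qj = j , subst (j ≤_) j+k≡b (m≤m+n j k) , ¬Qj , below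
    scan zero j j+0≡b below | yes Qj = ⊥-elim (¬Qb (subst Q (trans (sym (+-identityʳ j)) j+0≡b) Qj))
    scan (suc k) j j+k≡b below | yes Qj = scan k (suc j) (trans (sym (+-suc j k)) j+k≡b) below′
      where
      below′ : ∀ i → i < suc j → Q i
      below′ i i<sj with m≤n⇒m<n∨m≡n (≤-pred i<sj)
      ... | inj₁ i<j = below i i<j
      ... | inj₂ refl = Qj

module Residues where

  open import Data.Nat
  open import Data.Nat.Properties
  open import Data.Nat.DivMod
  open import Relation.Binary.PropositionalEquality

  σ : ℕ → ℕ
  σ 0 = 1
  σ 1 = 2
  σ 2 = 0
  σ k = k

  σ⁻¹ : ℕ → ℕ
  σ⁻¹ 0 = 2
  σ⁻¹ 1 = 0
  σ⁻¹ 2 = 1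
  σ⁻¹ k = k

  σ⁻¹∘σ : ∀ k → σ⁻¹ (σ k) ≡ k
  σ⁻¹∘σ 0 = refl
  σ⁻¹∘σ 1 = refl
  σ⁻¹∘σ 2 = refl
  σ⁻¹∘σ (suc (suc (suc k))) = refl

  σ∘σ⁻¹ : ∀ k → σ (σ⁻¹ k) ≡ k
  σ∘σ⁻¹ 0 = refl
  σ∘σ⁻¹ 1 = refl
  σ∘σ⁻¹ 2 = refl
  σ∘σ⁻¹ (suc (suc (suc k))) = refl

  σ-<3 : ∀ {c} → c < 3 → σ c < 3
  σ-<3 {0} _ = s≤s (s≤s z≤n)
  σ-<3 {1} _ = s≤s (s≤s (s≤s z≤n))
  σ-<3 {2} _ = s≤s z≤n
  σ-<3 {suc (suc (suc _))} (s≤s (s≤s (s≤s ())))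

  σ-<4 : ∀ {k} → k < 4 → σ k < 4
  σ-<4 {0} _ = s≤s (s≤s z≤n)
  σ-<4 {1} _ = s≤s (s≤s (s≤s z≤n))
  σ-<4 {2} _ = s≤s z≤n
  σ-<4 {3} _ = ≤-refl
  σ-<4 {suc (suc (suc (suc _)))} (s≤s (s≤s (s≤s (s≤s ()))))

  σ⁻¹-<4 : ∀ {k} → k < 4 → σ⁻¹ k < 4
  σ⁻¹-<4 {0} _ = s≤s (s≤s (s≤s z≤n))
  σ⁻¹-<4 {1} _ = s≤s z≤n
  σ⁻¹-<4 {2} _ = s≤s (s≤s z≤n)
  σ⁻¹-<4 {3} _ = ≤-refl
  σ⁻¹-<4 {suc (suc (suc (suc _)))} (s≤s (s≤s (s≤s (s≤s ()))))

  suc%3 : ∀ x → suc x % 3 ≡ σ (x % 3)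
  suc%3 x = trans (%-distribˡ-+ 1 x 3) (σ-mod (x % 3) (m%n<n x 3))
    where
    σ-mod : ∀ c → c < 3 → suc c % 3 ≡ σ c
    σ-mod 0 _ = refl
    σ-mod 1 _ = refl
    σ-mod 2 _ = refl
    σ-mod (suc (suc (suc _))) (s≤s (s≤s (s≤s ())))

module Sums where

  open import Data.Nat
  open import Data.Nat.Properties
  open import Algebra.Properties.CommutativeSemigroup +-commutativeSemigroup using (interchange)
  open import Data.Bool using (Bool; true; false)
  open import Data.Fin using (Fin; zero; suc; toℕ)
  open import Data.List using (List; []; _∷_; length)
  open import Data.List.Membership.Propositional using (_∈_)
  open import Data.List.Relation.Unary.Any using (here; there)
  open import Data.List.Relation.Unary.All as All using (All; []; _∷_)
  open import Data.List.Relation.Unary.Unique.Propositional using (Unique)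
  open import Data.List.Relation.Unary.AllPairs using ([]; _∷_)
  open import Data.Empty using (⊥-elim)
  open import Relation.Nullary using (¬_; yes; no)
  open import Relation.Binary.PropositionalEquality

  indicator : Bool → ℕ
  indicator true = 1
  indicator false = 0

  sumFin : ∀ n → (Fin n → ℕ) → ℕ
  sumFin zero _ = 0
  sumFin (suc n) h = h zero + sumFin n (λ i → h (suc i))

  sumFin-cong : ∀ n {h h′ : Fin n → ℕ} → (∀ i → h i ≡ h′ i) → sumFin n h ≡ sumFin n h′
  sumFin-cong zero _ = refl
  sumFin-cong (suc n) e = cong₂ _+_ (e zero) (sumFin-cong n (λ i → e (suc i)))

  sumRange : (ℕ → ℕ) → ℕ → ℕ → ℕ
  sumRange f a zero = 0
  sumRange f a (suc l) = f a + sumRange f (suc a) l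

  sumFin-toℕ : ∀ n (h : ℕ → ℕ) a → sumFin n (λ i → h (a + toℕ i)) ≡ sumRange h a n
  sumFin-toℕ zero h a = refl
  sumFin-toℕ (suc n) h a =
    cong₂ _+_ (cong h (+-identityʳ a)) (trans (sumFin-cong n (λ i → cong h (+-suc a (toℕ i)))) (sumFin-toℕ n h (suc a)))

  sumRange-cong : ∀ {f g : ℕ → ℕ} a l → (∀ y → a ≤ y → y < a + l → f y ≡ g y) → sumRange f a l ≡ sumRange g a l
  sumRange-cong a zero _ = refl
  sumRange-cong a (suc l) e = cong₂ _+_ (e a ≤-refl (subst (a <_) (sym (+-suc a l)) (s≤s (m≤m+n a l))))
    (sumRange-cong (suc a) l (λ y a<y y< → e y (<⇒≤ a<y) (subst (y <_) (sym (+-suc a l)) y<)))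

  sumRange-split : ∀ (f : ℕ → ℕ) a k l → sumRange f a (k + l) ≡ sumRange f a k + sumRange f (a + k) l
  sumRange-split f a zero l = cong (λ z → sumRange f z l) (sym (+-identityʳ a))
  sumRange-split f a (suc k) l = begin
    f a + sumRange f (suc a) (k + l)                    ≡⟨ cong (f a +_) (sumRange-split f (suc a) k l) ⟩
    f a + (sumRange f (suc a) k + sumRange f (suc a + k) l) ≡⟨ sym (+-assoc (f a) _ _) ⟩
    f a + sumRange f (suc a) k + sumRange f (suc a + k) l   ≡⟨ cong (λ z → f a + sumRange f (suc a) k + sumRange f z l) (sym (+-suc a k)) ⟩
    f a + sumRange f (suc a) k + sumRange f (a + suc k) l   ∎
    where open ≡-Reasoning

  sumRange-+ : ∀ (f g : ℕ → ℕ) a l → sumRange (λ y → f y + g y) a l ≡ sumRange f a l + sumRange g a l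
  sumRange-+ f g a zero = refl
  sumRange-+ f g a (suc l) rewrite sumRange-+ f g (suc a) l = interchange (f a) (g a) _ _

  sumRange-const : ∀ (f : ℕ → ℕ) c a l → (∀ y → a ≤ y → y < a + l → f y ≡ c) → sumRange f a l ≡ l * c
  sumRange-const f c a l e = trans (sumRange-cong a l e) (go a l)
    where
    go : ∀ a l → sumRange (λ _ → c) a l ≡ l * c
    go a zero = refl
    go a (suc l) = cong (c +_) (go (suc a) l)

  δ : ℕ → ℕ → ℕ
  δ x y with x ≟ y
  ... | yes _ = 1
  ... | no _ = 0

  sumRange-δ : ∀ p a l → a ≤ p → p < a + l → sumRange (λ y → δ y p) a l ≡ 1
  sumRange-δ p a zero a≤p p< = ⊥-elim (<⇒≱ p< (subst (_≤ p) (sym (+-identityʳ a)) a≤p))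
  sumRange-δ p a (suc l) a≤p p< with a ≟ p
  ... | yes refl = cong suc (trans (sumRange-const (λ y → δ y a) 0 (suc a) l δ-above) (*-zeroʳ l))
    where
    δ-above : ∀ y → suc a ≤ y → y < suc a + l → δ y a ≡ 0
    δ-above y a<y _ with y ≟ a
    ... | yes refl = ⊥-elim (<-irrefl refl a<y)
    ... | no _ = refl
  ... | no a≢p = sumRange-δ p (suc a) l (≤∧≢⇒< a≤p a≢p) (subst (p <_) (+-suc a l) p<)

  count : ℕ → List ℕ → ℕ
  count y [] = 0
  count y (p ∷ ps) = δ y p + count y ps

  sumRange-count : ∀ n ps → All (_< n) ps → sumRange (λ y → count y ps) 0 n ≡ length ps
  sumRange-count n [] [] = trans (sumRange-const _ 0 0 n (λ _ _ _ → refl)) (*-zeroʳ n)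
  sumRange-count n (p ∷ ps) (p< ∷ ps<) = trans (sumRange-+ (λ y → δ y p) (λ y → count y ps) 0 n)
    (cong₂ _+_ (sumRange-δ p 0 n z≤n p<) (sumRange-count n ps ps<))

  count-∉ : ∀ y ps → ¬ y ∈ ps → count y ps ≡ 0
  count-∉ y [] _ = refl
  count-∉ y (p ∷ ps) y∉ with y ≟ p
  ... | yes e = ⊥-elim (y∉ (here e))
  ... | no _ = count-∉ y ps (λ y∈ → y∉ (there y∈))

  count-∈ : ∀ y ps → Unique ps → y ∈ ps → count y ps ≡ 1
  count-∈ y (p ∷ ps) (p∉ ∷ _) (here refl) with y ≟ y
  ... | yes _ = cong suc (count-∉ y ps (λ y∈ → All.lookup p∉ y∈ refl))
  ... | no y≢y = ⊥-elim (y≢y refl)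
  count-∈ y (p ∷ ps) (p∉ ∷ u) (there y∈) with y ≟ p
  ... | yes refl = ⊥-elim (All.lookup p∉ y∈ refl)
  ... | no _ = count-∈ y ps u y∈

  sumRange-indicator : ∀ n (B : ℕ → Bool) ps → Unique ps → All (_< n) ps →
    (∀ y → B y ≡ true → y ∈ ps) → (∀ y → y ∈ ps → B y ≡ true) →
    sumRange (λ y → indicator (B y)) 0 n ≡ length ps
  sumRange-indicator n B ps u ps< complete sound =
    trans (sumRange-cong 0 n (λ y _ _ → pointwise y)) (sumRange-count n ps ps<)
    where
    pointwise : ∀ y → indicator (B y) ≡ count y ps
    pointwise y with B y in e
    ... | true = sym (count-∈ y ps u (complete y e))
    ... | false = sym (count-∉ y ps (λ y∈ → false≢true (trans (sym e) (sound y y∈))))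
      where
      false≢true : false ≢ true
      false≢true ()

module Cycles (R : ℕ → ℕ → Set) where

  open import Data.Nat
  open import Data.Nat.GeneralisedArithmetic using (fold; iterate)
  open import Data.Nat.Properties
  open import Data.List using (List; []; _∷_; _++_; length; map)
  open import Data.List.Properties using (length-map)
  open import Data.List.Membership.Propositional using (_∈_)
  open import Data.List.Membership.Propositional.Properties using (∈-map⁺; ∈-map⁻)
  open import Data.List.Relation.Unary.Unique.Propositional using (Unique)
  open import Data.List.Relation.Unary.Unique.Propositional.Properties as Unique using ()
  open import Data.Product using (_×_; _,_)
  open import Data.Sum using (_⊎_; inj₁; inj₂)
  open import Data.Empty using (⊥-elim)
  open import Relation.Nullary using (¬_; Dec; yes; no)
  open import Relation.Binary.PropositionalEquality
  open Indices

  data Walk : List ℕ → Set where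
    single : ∀ v → Walk (v ∷ [])
    cons   : ∀ u v vs → R u v → Walk (v ∷ vs) → Walk (u ∷ v ∷ vs)

  lastOr : ℕ → List ℕ → ℕ
  lastOr x [] = x
  lastOr x (y ∷ ys) = lastOr y ys

  -- The ℕ-level counterpart of HamCycleOn.
  record CycleOn (P : ℕ → Set) : Set where
    field
      start    : ℕ
      rest     : List ℕ
      walk     : Walk (start ∷ rest)
      closes   : R (lastOr start rest) start
      long     : 2 ≤ length rest
      unique   : Unique (start ∷ rest)
      sound    : ∀ w → w ∈ start ∷ rest → P w
      complete : ∀ w → P w → w ∈ start ∷ rest

  CycleOn-resp : ∀ {P Q : ℕ → Set} → (∀ w → P w → Q w) → (∀ w → Q w → P w) → CycleOn P → CycleOn Q
  CycleOn-resp P⇒Q Q⇒P C = record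
    { start = start ; rest = rest ; walk = walk ; closes = closes ; long = long ; unique = unique
    ; sound = λ w w∈ → P⇒Q w (sound w w∈) ; complete = λ w q → complete w (Q⇒P w q) }
    where open CycleOn C

  walk-nth : ∀ L → Walk L → ∀ {i} → suc i < length L → R (nth L i) (nth L (suc i))
  walk-nth (u ∷ v ∷ vs) (cons _ _ _ r _) {zero} _ = r
  walk-nth (u ∷ v ∷ vs) (cons _ _ _ _ p) {suc i} (s≤s i<) = walk-nth (v ∷ vs) p i<
  walk-nth (v ∷ []) (single v) {zero} (s≤s ())

  lastOr-nth : ∀ x xs → lastOr x xs ≡ nth (x ∷ xs) (length xs)
  lastOr-nth x [] = refl
  lastOr-nth x (y ∷ ys) = lastOr-nth y ys

  module Successor {P : ℕ → Set} (C : CycleOn P) where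
    open CycleOn C

    vertices : List ℕ
    vertices = start ∷ rest

    N : ℕ
    N = length vertices

    3≤N : 3 ≤ N
    3≤N = s≤s long

    next : ℕ → ℕ
    next w = nth vertices (sucMod N (indexOf w vertices))

    prev : ℕ → ℕ
    prev w = nth vertices (predMod N (indexOf w vertices))

    prev∈ : ∀ {w} → w ∈ vertices → prev w ∈ vertices
    prev∈ w∈ = nth∈ vertices (predMod< N _ (indexOf< vertices w∈))

    next-prev : ∀ {w} → w ∈ vertices → next (prev w) ≡ w
    next-prev {w} w∈ = begin
        nth vertices (sucMod N (indexOf (nth vertices (predMod N i)) vertices))
          ≡⟨ cong (λ k → nth vertices (sucMod N k)) (indexOf-nth vertices unique (predMod< N i i<)) ⟩
        nth vertices (sucMod N (predMod N i))
          ≡⟨ cong (nth vertices) (sucMod-predMod N i i<) ⟩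
        nth vertices i
          ≡⟨ nth-indexOf vertices w∈ ⟩
        w ∎
      where
      open ≡-Reasoning
      i = indexOf w vertices
      i< = indexOf< vertices w∈

    prev-next : ∀ {w} → w ∈ vertices → prev (next w) ≡ w
    prev-next {w} w∈ = begin
        nth vertices (predMod N (indexOf (nth vertices (sucMod N i)) vertices))
          ≡⟨ cong (λ k → nth vertices (predMod N k)) (indexOf-nth vertices unique (sucMod< N i i<)) ⟩
        nth vertices (predMod N (sucMod N i))
          ≡⟨ cong (nth vertices) (predMod-sucMod N i i<) ⟩
        nth vertices i
          ≡⟨ nth-indexOf vertices w∈ ⟩
        w ∎
      where
      open ≡-Reasoning
      i = indexOf w vertices
      i< = indexOf< vertices w∈

    closing : R (nth vertices (pred N)) (nth vertices 0)
    closing = subst (λ z → R z start) (lastOr-nth start rest) closes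

    R-next : ∀ {w} → w ∈ vertices → R w (next w)
    R-next {w} w∈ with sucMod-cases N (indexOf w vertices) (indexOf< vertices w∈)
    ... | inj₁ (si< , e) rewrite e =
      subst (λ z → R z (nth vertices (suc (indexOf w vertices)))) (nth-indexOf vertices w∈) (walk-nth vertices walk si<)
    ... | inj₂ (si≡ , e) rewrite e =
      subst (λ z → R z start) (trans (cong (λ k → nth vertices (pred k)) (sym si≡)) (nth-indexOf vertices w∈)) closing

    next≢prev : ∀ {w} → w ∈ vertices → next w ≢ prev w
    next≢prev w∈ e = sucMod≢predMod N _ 3≤N i< (nth-injective vertices unique (sucMod< N _ i<) (predMod< N _ i<) e)
      where i< = indexOf< vertices w∈

    R-prev : ∀ {w} → w ∈ vertices → R (prev w) w
    R-prev w∈ = subst (R _) (next-prev w∈) (R-next (prev∈ w∈))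

    Uses : ℕ → ℕ → Set
    Uses a b = next a ≡ b ⊎ prev a ≡ b

    Uses? : ∀ a b → Dec (Uses a b)
    Uses? a b with next a ≟ b | prev a ≟ b
    ... | yes e | _ = yes (inj₁ e)
    ... | no _ | yes e = yes (inj₂ e)
    ... | no ¬e | no ¬e′ = no λ { (inj₁ e) → ¬e e ; (inj₂ e) → ¬e′ e }

    Uses-sym : ∀ {a b} → a ∈ vertices → Uses a b → Uses b a
    Uses-sym a∈ (inj₁ refl) = inj₂ (prev-next a∈)
    Uses-sym a∈ (inj₂ refl) = inj₁ (next-prev a∈)

    uses-only-two : ∀ {a x y z} → a ∈ vertices → Uses a x → Uses a y → x ≢ y → Uses a z → z ≡ x ⊎ z ≡ y
    uses-only-two _ (inj₁ refl) (inj₁ refl) x≢y _ = ⊥-elim (x≢y refl)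
    uses-only-two _ (inj₁ refl) (inj₂ refl) _ (inj₁ refl) = inj₁ refl
    uses-only-two _ (inj₁ refl) (inj₂ refl) _ (inj₂ refl) = inj₂ refl
    uses-only-two _ (inj₂ refl) (inj₁ refl) _ (inj₁ refl) = inj₂ refl
    uses-only-two _ (inj₂ refl) (inj₁ refl) _ (inj₂ refl) = inj₁ refl
    uses-only-two _ (inj₂ refl) (inj₂ refl) x≢y _ = ⊥-elim (x≢y refl)

    uses-two : ∀ {a x} → a ∈ vertices → ¬ (∀ z → Uses a z → z ≡ x)
    uses-two a∈ only-x = next≢prev a∈ (trans (only-x _ (inj₁ refl)) (sym (only-x _ (inj₂ refl))))

    uses-other-two : ∀ {a x y z} → a ∈ vertices → (∀ w → Uses a w → w ≡ x ⊎ w ≡ y ⊎ w ≡ z) → ¬ Uses a x →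
                     Uses a y × Uses a z
    uses-other-two {a} a∈ among ¬x with among _ (inj₁ refl) | among _ (inj₂ refl) | next≢prev a∈
    ... | inj₁ e | _ | _ = ⊥-elim (¬x (inj₁ e))
    ... | _ | inj₁ e | _ = ⊥-elim (¬x (inj₂ e))
    ... | inj₂ (inj₁ e) | inj₂ (inj₂ e′) | _ = inj₁ e , inj₂ e′
    ... | inj₂ (inj₂ e) | inj₂ (inj₁ e′) | _ = inj₂ e′ , inj₁ e
    ... | inj₂ (inj₁ e) | inj₂ (inj₁ e′) | ≢ = ⊥-elim (≢ (trans e (sym e′)))
    ... | inj₂ (inj₂ e) | inj₂ (inj₂ e′) | ≢ = ⊥-elim (≢ (trans e (sym e′)))

    -- Walk forward from the index of a to the end, wrap around to index 0, and walk on to b.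
    next-closed : (S : ℕ → Set) → (∀ w → w ∈ vertices → S w → S (next w)) →
                  ∀ a → a ∈ vertices → S a → ∀ b → b ∈ vertices → S b
    next-closed S closed a a∈ Sa b b∈ =
      subst S (nth-indexOf vertices b∈) (forward (indexOf b vertices) 0 (indexOf< vertices b∈) S₀)
      where
      forward : ∀ d i → i + d < N → S (nth vertices i) → S (nth vertices (i + d))
      forward zero i _ s rewrite +-identityʳ i = s
      forward (suc d) i i+d< s rewrite +-suc i d =
        subst S step (closed _ (nth∈ vertices i+d<′) (forward d i i+d<′ s))
        where
        i+d<′ = ≤-trans (n≤1+n _) i+d<
        step : next (nth vertices (i + d)) ≡ nth vertices (suc (i + d))
        step with sucMod-cases N (i + d) i+d<′
        ... | inj₁ (_ , e) = cong (nth vertices) (trans (cong (sucMod N) (indexOf-nth vertices unique i+d<′)) e)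
        ... | inj₂ (si≡ , _) = ⊥-elim (<-irrefl si≡ i+d<)
      i = indexOf a vertices
      i< = indexOf< vertices a∈
      pred<N : pred N < N
      pred<N = ≤-refl
      i+d≡ : i + (pred N ∸ i) ≡ pred N
      i+d≡ = m+[n∸m]≡n (<⇒≤pred i<)
      S-last : S (nth vertices (pred N))
      S-last = subst (λ k → S (nth vertices k)) i+d≡
        (forward (pred N ∸ i) i (subst (_< N) (sym i+d≡) pred<N) (subst S (sym (nth-indexOf vertices a∈)) Sa))
      S₀ : S (nth vertices 0)
      S₀ = subst S wrap (closed _ (nth∈ vertices pred<N) S-last)
        where
        wrap : next (nth vertices (pred N)) ≡ nth vertices 0
        wrap with sucMod-cases N (pred N) pred<N
        ... | inj₁ (N< , _) = ⊥-elim (<-irrefl refl N<)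
        ... | inj₂ (_ , e) = cong (nth vertices) (trans (cong (sucMod N) (indexOf-nth vertices unique pred<N)) e)

  module Automorphism (f f⁻¹ : ℕ → ℕ) (f⁻¹∘f : ∀ x → f⁻¹ (f x) ≡ x) (f∘f⁻¹ : ∀ x → f (f⁻¹ x) ≡ x)
                      (R-pres : ∀ {x y} → R x y → R (f x) (f y)) where

    f-injective : ∀ {x y} → f x ≡ f y → x ≡ y
    f-injective {x} {y} e = trans (sym (f⁻¹∘f x)) (trans (cong f⁻¹ e) (f⁻¹∘f y))

    map-walk : ∀ {L} → Walk L → Walk (map f L)
    map-walk (single v) = single (f v)
    map-walk (cons u v vs r p) = cons (f u) (f v) (map f vs) (R-pres r) (map-walk p)

    map-lastOr : ∀ x xs → lastOr (f x) (map f xs) ≡ f (lastOr x xs)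
    map-lastOr x [] = refl
    map-lastOr x (y ∷ ys) = map-lastOr y ys

    map-cycle : ∀ {P : ℕ → Set} → CycleOn P → CycleOn (λ w → P (f⁻¹ w))
    map-cycle {P} C = record
      { start = f start
      ; rest = map f rest
      ; walk = map-walk walk
      ; closes = subst (λ z → R z (f start)) (sym (map-lastOr start rest)) (R-pres closes)
      ; long = subst (2 ≤_) (sym (length-map f rest)) long
      ; unique = Unique.map⁺ f-injective unique
      ; sound = sound′
      ; complete = λ w p → subst (_∈ map f (start ∷ rest)) (f∘f⁻¹ w) (∈-map⁺ f (complete (f⁻¹ w) p))
      }
      where
      open CycleOn C
      sound′ : ∀ w → w ∈ map f (start ∷ rest) → P (f⁻¹ w)
      sound′ w w∈ with ∈-map⁻ f w∈
      ... | y , y∈ , refl = subst P (sym (f⁻¹∘f y)) (sound y y∈)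

    module _ {P : ℕ → Set} (C : CycleOn P) where
      private
        module C = Successor C
        module C′ = Successor (map-cycle C)

      next-map : ∀ {w} → w ∈ C.vertices → C′.next (f w) ≡ f (C.next w)
      next-map {w} w∈ = begin
        nth (map f C.vertices) (sucMod (length (map f C.vertices)) (indexOf (f w) (map f C.vertices)))
          ≡⟨ cong₂ (λ k i → nth (map f C.vertices) (sucMod k i)) (length-map f C.vertices) (map-indexOf f f-injective w C.vertices) ⟩
        nth (map f C.vertices) (sucMod C.N (indexOf w C.vertices))
          ≡⟨ map-nth f C.vertices (sucMod< C.N _ (indexOf< C.vertices w∈)) ⟩
        f (C.next w) ∎
        where open ≡-Reasoning

      prev-map : ∀ {w} → w ∈ C.vertices → C′.prev (f w) ≡ f (C.prev w)
      prev-map {w} w∈ = begin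
        nth (map f C.vertices) (predMod (length (map f C.vertices)) (indexOf (f w) (map f C.vertices)))
          ≡⟨ cong₂ (λ k i → nth (map f C.vertices) (predMod k i)) (length-map f C.vertices) (map-indexOf f f-injective w C.vertices) ⟩
        nth (map f C.vertices) (predMod C.N (indexOf w C.vertices))
          ≡⟨ map-nth f C.vertices (predMod< C.N _ (indexOf< C.vertices w∈)) ⟩
        f (C.prev w) ∎
        where open ≡-Reasoning

      Uses-map⁻ : ∀ {a b} → a ∈ C.vertices → C′.Uses (f a) (f b) → C.Uses a b
      Uses-map⁻ a∈ (inj₁ e) = inj₁ (f-injective (trans (sym (next-map a∈)) e))
      Uses-map⁻ a∈ (inj₂ e) = inj₂ (f-injective (trans (sym (prev-map a∈)) e))

  module AutomorphismPower (f f⁻¹ : ℕ → ℕ) (f⁻¹∘f : ∀ x → f⁻¹ (f x) ≡ x) (f∘f⁻¹ : ∀ x → f (f⁻¹ x) ≡ x)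
                           (R-pres : ∀ {x y} → R x y → R (f x) (f y)) where

    iterate-fold : ∀ t x → iterate f⁻¹ (fold x f t) t ≡ x
    iterate-fold zero x = refl
    iterate-fold (suc t) x = trans (cong (λ y → iterate f⁻¹ y t) (f⁻¹∘f (fold x f t))) (iterate-fold t x)

    fold-iterate : ∀ t x → fold (iterate f⁻¹ x t) f t ≡ x
    fold-iterate zero x = refl
    fold-iterate (suc t) x = trans (cong f (fold-iterate t (f⁻¹ x))) (f∘f⁻¹ x)

    R-pres-fold : ∀ t {x y} → R x y → R (fold x f t) (fold y f t)
    R-pres-fold zero r = r
    R-pres-fold (suc t) r = R-pres (R-pres-fold t r)

    module Power (t : ℕ) = Automorphism (λ x → fold x f t) (λ x → iterate f⁻¹ x t) (iterate-fold t) (fold-iterate t) (R-pres-fold t)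

  walk-++ : ∀ x xs y ys → Walk (x ∷ xs) → R (lastOr x xs) y → Walk (y ∷ ys) → Walk (x ∷ xs ++ y ∷ ys)
  walk-++ x [] y ys (single x) r w = cons x y ys r w
  walk-++ x (x′ ∷ xs) y ys (cons x x′ xs r₀ w₀) r w = cons x x′ (xs ++ y ∷ ys) r₀ (walk-++ x′ xs y ys w₀ r w)

  lastOr-++ : ∀ x xs y ys → lastOr x (xs ++ y ∷ ys) ≡ lastOr y ys
  lastOr-++ x [] y ys = refl
  lastOr-++ x (x′ ∷ xs) y ys = lastOr-++ x′ xs y ys

module GraphFromRelation (n : ℕ) (R : ℕ → ℕ → Set) (R? : ∀ x y → Dec (R x y))
                    (R-sym : ∀ {x y} → R x y → R y x) (R-irrefl : ∀ x → ¬ R x x) where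

  open import Data.Nat.Properties using (_≟_; _<?_)
  open import Data.Bool using (Bool; true; false; _∧_) renaming (_≟_ to _≟ᵇ_)
  open import Data.Fin as Fin using (Fin; toℕ; fromℕ<)
  open import Data.Fin.Properties using (toℕ-injective; toℕ<n; toℕ-fromℕ<; fromℕ<-toℕ)
  open import Data.List using (allFin; List; []; _∷_; _++_; length; map; filter; tabulate; concatMap)
  open import Data.List.Properties using (length-map; length-++)
  open import Data.List.Membership.Propositional using (_∈_)
  open import Data.List.Relation.Unary.Any using (here; there)
  open import Data.List.Relation.Unary.All as All using (All; []; _∷_)
  open import Data.List.Relation.Unary.Unique.Propositional using (Unique)
  open import Data.List.Relation.Unary.Unique.Propositional.Properties as Unique using ()
  open import Data.Product using (Σ; _×_; _,_; proj₁; proj₂)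
  open import Relation.Nullary using (yes; no; does)
  open import Relation.Nullary.Decidable using (dec-true; dec-false)
  open import Relation.Binary.PropositionalEquality
  open import Defs hiding (sym)
  open Cycles R
  open Sums

  does-true : ∀ {P : Set} (d : Dec P) → does d ≡ true → P
  does-true (yes p) _ = p

  does-sym : ∀ x y → does (R? x y) ≡ does (R? y x)
  does-sym x y with R? y x
  ... | yes r = dec-true (R? x y) (R-sym r)
  ... | no ¬r = dec-false (R? x y) (λ r → ¬r (R-sym r))

  G : Graph n
  adj G u v = does (R? (toℕ u) (toℕ v))
  Graph.sym G u v = does-sym (toℕ u) (toℕ v)
  irrefl G v = dec-false (R? (toℕ v) (toℕ v)) (R-irrefl (toℕ v))

  Adj⇒R : ∀ {u v} → Adj G u v → R (toℕ u) (toℕ v)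
  Adj⇒R {u} {v} = does-true (R? (toℕ u) (toℕ v))

  R⇒Adj : ∀ {u v} → R (toℕ u) (toℕ v) → Adj G u v
  R⇒Adj {u} {v} = dec-true (R? (toℕ u) (toℕ v))

  record Corresponds (P′ : Fin n → Set) (P : ℕ → Set) : Set where
    field
      to      : ∀ w → P′ w → P (toℕ w)
      from    : ∀ w → P (toℕ w) → P′ w
      bounded : ∀ x → P x → x < n

  -- HamCycleOn mentions a last-vertex function local to its definition; it is recovered
  -- here as the one that makes the definition hold by refl.
  module LastVertex (P′ : Fin n → Set) where
    unfold : Σ (Fin n → List (Fin n) → Fin n) λ last → HamCycleOn G P′ ≡ (Σ (Fin n) λ v₀ → Σ (List (Fin n)) λ vs →
        Path G (v₀ ∷ vs)
      × Adj G (last v₀ vs) v₀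
      × 2 ≤ length vs
      × Unique (v₀ ∷ vs)
      × (∀ w → w ∈ (v₀ ∷ vs) → P′ w)
      × (∀ w → P′ w → w ∈ (v₀ ∷ vs)))
    unfold = _ , refl

    last : Fin n → List (Fin n) → Fin n
    last = proj₁ unfold

    toℕ-last : ∀ x xs → toℕ (last x xs) ≡ lastOr (toℕ x) (map toℕ xs)
    toℕ-last x [] = refl
    toℕ-last x (y ∷ ys) = toℕ-last y ys

  walk-toℕ : ∀ {l} → Path G l → Walk (map toℕ l)
  walk-toℕ (single v) = single (toℕ v)
  walk-toℕ (cons u v vs a p) = cons (toℕ u) (toℕ v) (map toℕ vs) (Adj⇒R a) (walk-toℕ p)

  ∈-toℕ⁺ : ∀ {w} {l : List (Fin n)} → w ∈ l → toℕ w ∈ map toℕ l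
  ∈-toℕ⁺ (here refl) = here refl
  ∈-toℕ⁺ (there p) = there (∈-toℕ⁺ p)

  ∈-toℕ⁻ : ∀ {x} {l : List (Fin n)} → x ∈ map toℕ l → Σ (Fin n) λ w → w ∈ l × toℕ w ≡ x
  ∈-toℕ⁻ {l = y ∷ l} (here refl) = y , here refl , refl
  ∈-toℕ⁻ {l = y ∷ l} (there p) with ∈-toℕ⁻ p
  ... | w , w∈ , e = w , there w∈ , e

  fromHamCycleOn : ∀ {P′ P} → Corresponds P′ P → HamCycleOn G P′ → CycleOn P
  fromHamCycleOn {P′} {P} c (v₀ , vs , p , a , len , u , snd , cmp) = record
    { start = toℕ v₀
    ; rest = map toℕ vs
    ; walk = walk-toℕ p
    ; closes = subst (λ z → R z (toℕ v₀)) (toℕ-last v₀ vs) (Adj⇒R a)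
    ; long = subst (2 ≤_) (sym (length-map toℕ vs)) len
    ; unique = Unique.map⁺ toℕ-injective u
    ; sound = sound′
    ; complete = λ w q → subst (_∈ map toℕ (v₀ ∷ vs)) (toℕ-fromℕ< (bounded w q))
                           (∈-toℕ⁺ (cmp _ (from _ (subst P (sym (toℕ-fromℕ< (bounded w q))) q))))
    }
    where
    open LastVertex P′
    open Corresponds c
    sound′ : ∀ w → w ∈ map toℕ (v₀ ∷ vs) → P w
    sound′ w w∈ with ∈-toℕ⁻ w∈
    ... | x , x∈ , refl = to x (snd x x∈)

  lift : (xs : List ℕ) → All (_< n) xs → List (Fin n)
  lift [] [] = []
  lift (x ∷ xs) (x< ∷ xs<) = fromℕ< x< ∷ lift xs xs<

  map-toℕ-lift : ∀ xs xs< → map toℕ (lift xs xs<) ≡ xs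
  map-toℕ-lift [] [] = refl
  map-toℕ-lift (x ∷ xs) (x< ∷ xs<) = cong₂ _∷_ (toℕ-fromℕ< x<) (map-toℕ-lift xs xs<)

  walk-lift : ∀ xs xs< → Walk xs → Path G (lift xs xs<)
  walk-lift (x ∷ []) (_ ∷ []) (single x) = single _
  walk-lift (x ∷ y ∷ xs) (x< ∷ y< ∷ xs<) (cons x y xs r p) =
    cons _ _ _ (R⇒Adj (subst₂ R (sym (toℕ-fromℕ< x<)) (sym (toℕ-fromℕ< y<)) r)) (walk-lift (y ∷ xs) (y< ∷ xs<) p)

  toHamCycleOn : ∀ {P′ P} → Corresponds P′ P → CycleOn P → HamCycleOn G P′
  toHamCycleOn {P′} {P} c C =
      v₀ , vs , walk-lift (start ∷ rest) bounds walk
    , R⇒Adj (subst₂ R (sym last≡) (sym (toℕ-fromℕ< start<)) closes)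
    , subst (2 ≤_) (sym lift-length) long
    , Unique.map⁻ (subst Unique (sym (map-toℕ-lift (start ∷ rest) bounds)) unique)
    , (λ w w∈ → from w (sound _ (∈-lift w∈)))
    , (λ w q → lift-∈ (complete _ (to w q)))
    where
    open CycleOn C
    open Corresponds c
    open LastVertex P′
    bounds : All (_< n) (start ∷ rest)
    bounds = All.tabulate (λ {w} w∈ → bounded w (sound w w∈))
    start< = All.head bounds
    v₀ = fromℕ< start<
    vs = lift rest (All.tail bounds)
    lift-length : length vs ≡ length rest
    lift-length = trans (sym (length-map toℕ vs)) (cong length (map-toℕ-lift rest (All.tail bounds)))
    last≡ : toℕ (last v₀ vs) ≡ lastOr start rest
    last≡ = trans (toℕ-last v₀ vs) (cong₂ lastOr (toℕ-fromℕ< start<) (map-toℕ-lift rest (All.tail bounds)))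
    ∈-lift : ∀ {w} → w ∈ v₀ ∷ vs → toℕ w ∈ start ∷ rest
    ∈-lift {w} w∈ = subst (toℕ w ∈_) (map-toℕ-lift (start ∷ rest) bounds) (∈-toℕ⁺ w∈)
    lift-∈ : ∀ {w} → toℕ w ∈ start ∷ rest → w ∈ v₀ ∷ vs
    lift-∈ {w} w∈ with ∈-toℕ⁻ (subst (toℕ w ∈_) (sym (map-toℕ-lift (start ∷ rest) bounds)) w∈)
    ... | u , u∈ , e = subst (_∈ v₀ ∷ vs) (toℕ-injective e) u∈

  length-filter-tabulate : ∀ {A : Set} k (g : Fin k → A) (b : A → Bool) →
    length (filter (λ x → b x ≟ᵇ true) (tabulate g)) ≡ sumFin k (λ i → indicator (b (g i)))
  length-filter-tabulate zero g b = refl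
  length-filter-tabulate (suc k) g b with b (g Fin.zero)
  ... | true = cong suc (length-filter-tabulate k (λ i → g (Fin.suc i)) b)
  ... | false = length-filter-tabulate k (λ i → g (Fin.suc i)) b

  length-filter-filter-tabulate : ∀ {A : Set} {Q : A → Set} k (g : Fin k → A) (b : A → Bool) (Q? : ∀ x → Dec (Q x)) →
    length (filter Q? (filter (λ x → b x ≟ᵇ true) (tabulate g))) ≡ sumFin k (λ i → indicator (b (g i) ∧ does (Q? (g i))))
  length-filter-filter-tabulate zero g b Q? = refl
  length-filter-filter-tabulate (suc k) g b Q? with b (g Fin.zero)
  ... | false = length-filter-filter-tabulate k (λ i → g (Fin.suc i)) b Q?
  ... | true with does (Q? (g Fin.zero))
  ...   | true = cong suc (length-filter-filter-tabulate k (λ i → g (Fin.suc i)) b Q?)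
  ...   | false = length-filter-filter-tabulate k (λ i → g (Fin.suc i)) b Q?

  length-concatMap-tabulate : ∀ {A B : Set} k (g : Fin k → A) (F : A → List B) →
    length (concatMap F (tabulate g)) ≡ sumFin k (λ i → length (F (g i)))
  length-concatMap-tabulate zero g F = refl
  length-concatMap-tabulate (suc k) g F =
    trans (length-++ (F (g Fin.zero))) (cong (length (F (g Fin.zero)) +_) (length-concatMap-tabulate k (λ i → g (Fin.suc i)) F))

  degreeℕ : ℕ → ℕ
  degreeℕ x = sumRange (λ y → indicator (does (R? x y))) 0 n

  degree≡degreeℕ : ∀ v → degree G v ≡ degreeℕ (toℕ v)
  degree≡degreeℕ v = trans (length-filter-tabulate n (λ i → i) (adj G v)) (sumFin-toℕ n (λ y → indicator (does (R? (toℕ v) y))) 0)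

  upDegreeℕ : ℕ → ℕ
  upDegreeℕ x = sumRange (λ y → indicator (does (R? x y) ∧ does (x <? y))) 0 n

  edgeCount≡ : edgeCount G ≡ sumRange upDegreeℕ 0 n
  edgeCount≡ = begin
      length (concatMap above (allFin n))
        ≡⟨ length-concatMap-tabulate n (λ i → i) above ⟩
      sumFin n (λ u → length (above u))
        ≡⟨ sumFin-cong n count-above ⟩
      sumFin n (λ u → upDegreeℕ (toℕ u))
        ≡⟨ sumFin-toℕ n upDegreeℕ 0 ⟩
      sumRange upDegreeℕ 0 n ∎
    where
    open ≡-Reasoning
    above : Fin n → List (Fin n × Fin n)
    above u = map (λ v → (u , v)) (filter (λ v → toℕ u <? toℕ v) (neighbours G u))
    count-above : ∀ u → length (above u) ≡ upDegreeℕ (toℕ u)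
    count-above u = begin
      length (above u)
        ≡⟨ length-map (λ v → (u , v)) (filter (λ v → toℕ u <? toℕ v) (neighbours G u)) ⟩
      length (filter (λ v → toℕ u <? toℕ v) (neighbours G u))
        ≡⟨ length-filter-filter-tabulate n (λ i → i) (adj G u) (λ v → toℕ u <? toℕ v) ⟩
      sumFin n (λ v → indicator (adj G u v ∧ does (toℕ u <? toℕ v)))
        ≡⟨ sumFin-toℕ n (λ y → indicator (does (R? (toℕ u) y) ∧ does (toℕ u <? y))) 0 ⟩
      upDegreeℕ (toℕ u) ∎

  -- As for HamCycleOn, the end-of-walk function local to Connected, recovered by refl.
  module WalkEnd where
    unfold : Σ (Fin n → List (Fin n) → Fin n) λ end →
      Connected G ≡ (∀ (u v : Fin n) → Σ (List (Fin n)) λ vs → Path G (u ∷ vs) × end u vs ≡ v)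
    unfold = _ , refl

    end : Fin n → List (Fin n) → Fin n
    end = proj₁ unfold

  open WalkEnd using (end)

  Reach : Fin n → Fin n → Set
  Reach u v = Σ (List (Fin n)) λ vs → Path G (u ∷ vs) × end u vs ≡ v

  reach-refl : ∀ u → Reach u u
  reach-refl u = [] , single u , refl

  reach-step : ∀ {u v w} → Reach u v → Adj G v w → Reach u w
  reach-step {u} {v} {w} (vs , p , refl) a = vs ++ w ∷ [] , snoc u vs p a
    where
    snoc : ∀ u vs → Path G (u ∷ vs) → Adj G (end u vs) w → Path G (u ∷ vs ++ w ∷ []) × end u (vs ++ w ∷ []) ≡ w
    snoc u [] (single u) a = cons u w [] a (single w) , refl
    snoc u (y ∷ ys) (cons u y ys a p) b with snoc y ys p b
    ... | q , e = cons u y (ys ++ w ∷ []) a q , e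

  connected-through : ∀ x a → a < n → R x a → CycleOn (λ w → w < n × w ≢ x) → Connected G
  connected-through x a a<n xa C u v = reach-from u v
    where
    open CycleOn C
    open Successor C
    on-cycle : ∀ {w} → w < n → w ≢ x → w ∈ vertices
    on-cycle w<n w≢x = complete _ (w<n , w≢x)
    a∈ : a ∈ vertices
    a∈ = on-cycle a<n (λ a≡x → R-irrefl x (subst (R x) a≡x xa))
    toFin-Adj : ∀ {y z} (y<n : y < n) (z<n : z < n) → R y z → Adj G (fromℕ< y<n) (fromℕ< z<n)
    toFin-Adj y<n z<n r = R⇒Adj (subst₂ R (sym (toℕ-fromℕ< y<n)) (sym (toℕ-fromℕ< z<n)) r)
    toFin-≡ : ∀ {w : Fin n} → toℕ w ≡ x → (x<n : x < n) → w ≡ fromℕ< x<n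
    toFin-≡ e x<n = toℕ-injective (trans e (sym (toℕ-fromℕ< x<n)))
    module _ (u : Fin n) where
      Reachable : ℕ → Set
      Reachable w = (w<n : w < n) → Reach u (fromℕ< w<n)
      closed : ∀ w → w ∈ vertices → Reachable w → Reachable (next w)
      closed w w∈ r next< = reach-step (r w<n) (toFin-Adj w<n next< (R-next w∈))
        where w<n = proj₁ (sound w w∈)
      start-reachable : Σ ℕ λ s → s ∈ vertices × Reachable s
      start-reachable with toℕ u ≟ x
      ... | yes u≡x = a , a∈ , λ a<n′ →
        reach-step (reach-refl u) (subst (λ z → Adj G z (fromℕ< a<n′)) (sym (toFin-≡ u≡x x<n)) (toFin-Adj x<n a<n′ xa))
        where x<n = subst (_< n) u≡x (toℕ<n u)
      ... | no u≢x = toℕ u , on-cycle (toℕ<n u) u≢x , λ u<n → subst (Reach u) (sym (fromℕ<-toℕ u u<n)) (reach-refl u)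
      cycle-reachable : ∀ w → w ∈ vertices → Reachable w
      cycle-reachable = next-closed Reachable closed _ (proj₁ (proj₂ start-reachable)) (proj₂ (proj₂ start-reachable))
      reach-from : ∀ v → Reach u v
      reach-from v with toℕ v ≟ x
      ... | yes v≡x = subst (Reach u) (sym (toFin-≡ v≡x x<n))
                        (reach-step (cycle-reachable a a∈ a<n) (toFin-Adj a<n x<n (R-sym xa)))
        where x<n = subst (_< n) v≡x (toℕ<n v)
      ... | no v≢x = subst (Reach u) (fromℕ<-toℕ v (toℕ<n v)) (cycle-reachable (toℕ v) (on-cycle (toℕ<n v) v≢x) (toℕ<n v))

-- Cycles of the construction are written as lists of intervals [s, e) whose endpoints are
-- constants c or c + d for the symbolic d.  The Boolean comparisons below only look at the
-- constants, so disjointness and coverage of such interval lists are decided by evaluation.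
module Intervals (d : ℕ) where

  open import Data.Nat
  open import Data.Nat.Properties
  open import Data.Bool using (Bool; true; false; T; _∧_; _∨_)
  open import Data.Bool.Properties using (T-∧; T-∨)
  open import Data.List using (List; []; _∷_; _++_; concatMap)
  open import Data.Bool.ListAction using (all; any)
  open import Data.List.Membership.Propositional using (_∈_)
  open import Data.List.Membership.Propositional.Properties using (∈-++⁺ˡ; ∈-++⁺ʳ; ∈-++⁻)
  open import Data.List.Relation.Unary.Any as Any using (Any; here; there)
  open import Data.List.Relation.Unary.Any.Properties using (any⁻)
  open import Data.List.Relation.Unary.All as All using (All; []; _∷_)
  open import Data.List.Relation.Unary.All.Properties as All using (all⁺)
  open import Data.List.Relation.Unary.Unique.Propositional using (Unique)
  open import Data.List.Relation.Unary.AllPairs using (AllPairs; []; _∷_)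
  open import Data.List.Relation.Unary.Unique.Propositional.Properties using (++⁺)
  open import Data.Product using (Σ; _×_; _,_; proj₁; proj₂)
  open import Data.Sum using (inj₁; inj₂)
  open import Data.Empty using (⊥; ⊥-elim)
  open import Function.Base using (_∘_)
  open import Function.Bundles using (Equivalence)
  open import Relation.Nullary using (¬_; yes; no)
  open import Relation.Binary.PropositionalEquality

  data Point : Set where
    low high : ℕ → Point

  value : Point → ℕ
  value (low c) = c
  value (high c) = c + d

  sucᵖ : Point → Point
  sucᵖ (low c) = low (suc c)
  sucᵖ (high c) = high (suc c)

  _≟ᵖ_ : Point → Point → Bool
  low c ≟ᵖ low c′ = c ≡ᵇ c′
  high c ≟ᵖ high c′ = c ≡ᵇ c′
  _ ≟ᵖ _ = false

  _≤ᵖ_ : Point → Point → Bool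
  low c ≤ᵖ low c′ = c ≤ᵇ c′
  high c ≤ᵖ high c′ = c ≤ᵇ c′
  low c ≤ᵖ high c′ = c ≤ᵇ c′
  high c ≤ᵖ low c′ = false

  _<ᵖ_ : Point → Point → Bool
  p <ᵖ q = sucᵖ p ≤ᵖ q

  ≟ᵖ-sound : ∀ p q → T (p ≟ᵖ q) → p ≡ q
  ≟ᵖ-sound (low c) (low c′) t = cong low (≡ᵇ⇒≡ c c′ t)
  ≟ᵖ-sound (high c) (high c′) t = cong high (≡ᵇ⇒≡ c c′ t)

  ≤ᵖ-sound : ∀ p q → T (p ≤ᵖ q) → value p ≤ value q
  ≤ᵖ-sound (low c) (low c′) t = ≤ᵇ⇒≤ c c′ t
  ≤ᵖ-sound (high c) (high c′) t = +-monoˡ-≤ d (≤ᵇ⇒≤ c c′ t)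
  ≤ᵖ-sound (low c) (high c′) t = ≤-trans (≤ᵇ⇒≤ c c′ t) (m≤m+n c′ d)

  <ᵖ-sound : ∀ p q → T (p <ᵖ q) → value p < value q
  <ᵖ-sound (low c) q t = ≤ᵖ-sound (low (suc c)) q t
  <ᵖ-sound (high c) q t = ≤ᵖ-sound (high (suc c)) q t

  <ᵖ⇒≤ᵖ : ∀ p q → T (p <ᵖ q) → T (p ≤ᵖ q)
  <ᵖ⇒≤ᵖ (low c) (low c′) t = ≤⇒≤ᵇ (≤-trans (n≤1+n c) (≤ᵇ⇒≤ (suc c) c′ t))
  <ᵖ⇒≤ᵖ (high c) (high c′) t = ≤⇒≤ᵇ (≤-trans (n≤1+n c) (≤ᵇ⇒≤ (suc c) c′ t))
  <ᵖ⇒≤ᵖ (low c) (high c′) t = ≤⇒≤ᵇ (≤-trans (n≤1+n c) (≤ᵇ⇒≤ (suc c) c′ t))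

  -- value q ∸ value p, computed on the constants so that it reduces for symbolic d.
  size : Point → Point → ℕ
  size (low c) (low c′) = c′ ∸ c
  size (high c) (high c′) = c′ ∸ c
  size (low c) (high c′) = (c′ ∸ c) + d
  size (high c) (low c′) = 0

  size-sound : ∀ p q → T (p ≤ᵖ q) → value p + size p q ≡ value q
  size-sound (low c) (low c′) t = m+[n∸m]≡n (≤ᵇ⇒≤ c c′ t)
  size-sound (high c) (high c′) t = begin
    c + d + (c′ ∸ c) ≡⟨ +-assoc c d (c′ ∸ c) ⟩
    c + (d + (c′ ∸ c)) ≡⟨ cong (c +_) (+-comm d (c′ ∸ c)) ⟩
    c + ((c′ ∸ c) + d) ≡⟨ sym (+-assoc c (c′ ∸ c) d) ⟩
    c + (c′ ∸ c) + d ≡⟨ cong (_+ d) (m+[n∸m]≡n (≤ᵇ⇒≤ c c′ t)) ⟩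
    c′ + d ∎
    where open ≡-Reasoning
  size-sound (low c) (high c′) t = trans (sym (+-assoc c (c′ ∸ c) d)) (cong (_+ d) (m+[n∸m]≡n (≤ᵇ⇒≤ c c′ t)))

  size-sucᵖ : ∀ p → size p (sucᵖ p) ≡ 1
  size-sucᵖ (low c) = m+n∸n≡m 1 c
  size-sucᵖ (high c) = m+n∸n≡m 1 c

  range : ℕ → ℕ → List ℕ
  range a zero = []
  range a (suc l) = a ∷ range (suc a) l

  ∈-range⁻ : ∀ {w} a l → w ∈ range a l → a ≤ w × w < a + l
  ∈-range⁻ a (suc l) (here refl) = ≤-refl , subst (a <_) (sym (+-suc a l)) (s≤s (m≤m+n a l))
  ∈-range⁻ {w} a (suc l) (there w∈) with ∈-range⁻ (suc a) l w∈
  ... | a<w , w< = <⇒≤ a<w , subst (w <_) (sym (+-suc a l)) w<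

  ∈-range⁺ : ∀ {w} a l → a ≤ w → w < a + l → w ∈ range a l
  ∈-range⁺ {w} a zero a≤w w< = ⊥-elim (<⇒≱ w< (subst (_≤ w) (sym (+-identityʳ a)) a≤w))
  ∈-range⁺ {w} a (suc l) a≤w w< with m≤n⇒m<n∨m≡n a≤w
  ... | inj₂ refl = here refl
  ... | inj₁ a<w = there (∈-range⁺ (suc a) l a<w (subst (w <_) (+-suc a l) w<))

  range-unique : ∀ a l → Unique (range a l)
  range-unique a zero = []
  range-unique a (suc l) = All.tabulate (λ w∈ → <⇒≢ (proj₁ (∈-range⁻ (suc a) l w∈))) ∷ range-unique (suc a) l

  Interval : Set
  Interval = Point × Point

  _≟ᴵ_ : Interval → Interval → Bool
  (s , e) ≟ᴵ (s′ , e′) = (s ≟ᵖ s′) ∧ (e ≟ᵖ e′)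

  ≟ᴵ-sound : ∀ I J → T (I ≟ᴵ J) → I ≡ J
  ≟ᴵ-sound (s , e) (s′ , e′) t with Equivalence.to T-∧ t
  ... | ts , te = cong₂ _,_ (≟ᵖ-sound s s′ ts) (≟ᵖ-sound e e′ te)

  elements : Interval → List ℕ
  elements (s , e) = range (value s) (size s e)

  _∈ᴵ_ : ℕ → Interval → Set
  w ∈ᴵ (s , e) = value s ≤ w × w < value e

  nonempty : Interval → Bool
  nonempty (s , e) = s <ᵖ e

  ∈-elements⁻ : ∀ {w} I → T (nonempty I) → w ∈ elements I → w ∈ᴵ I
  ∈-elements⁻ (s , e) t w∈ with ∈-range⁻ (value s) (size s e) w∈
  ... | s≤w , w< = s≤w , subst (_ <_) (size-sound s e (<ᵖ⇒≤ᵖ s e t)) w<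

  ∈-elements⁺ : ∀ {w} I → T (nonempty I) → w ∈ᴵ I → w ∈ elements I
  ∈-elements⁺ (s , e) t (s≤w , w<) = ∈-range⁺ (value s) (size s e) s≤w (subst (_ <_) (sym (size-sound s e (<ᵖ⇒≤ᵖ s e t))) w<)

  disjoint : Interval → Interval → Bool
  disjoint (s , e) (s′ , e′) = (e ≤ᵖ s′) ∨ (e′ ≤ᵖ s)

  disjoint-sound : ∀ I J {w} → T (disjoint I J) → w ∈ᴵ I → w ∈ᴵ J → ⊥
  disjoint-sound (s , e) (s′ , e′) t (s≤w , w<e) (s′≤w , w<e′) with Equivalence.to T-∨ t
  ... | inj₁ e≤s′ = <⇒≱ w<e (≤-trans (≤ᵖ-sound e s′ e≤s′) s′≤w)
  ... | inj₂ e′≤s = <⇒≱ w<e′ (≤-trans (≤ᵖ-sound e′ s e′≤s) s≤w)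

  pairwiseDisjoint : List Interval → Bool
  pairwiseDisjoint [] = true
  pairwiseDisjoint (I ∷ Is) = all (disjoint I) Is ∧ pairwiseDisjoint Is

  tiles : Point → List Interval → Point → Bool
  tiles a [] b = a ≟ᵖ b
  tiles a ((s , e) ∷ Is) b = (a ≟ᵖ s) ∧ (s <ᵖ e) ∧ tiles e Is b

  tiles-sound : ∀ a Is b {w} → T (tiles a Is b) → value a ≤ w → w < value b → Σ Interval λ I → I ∈ Is × w ∈ᴵ I
  tiles-sound a [] b t a≤w w<b with ≟ᵖ-sound a b t
  ... | refl = ⊥-elim (<⇒≱ w<b a≤w)
  tiles-sound a ((s , e) ∷ Is) b {w} t a≤w w<b with Equivalence.to T-∧ t
  ... | t-as , t′ with Equivalence.to T-∧ t′ | ≟ᵖ-sound a s t-as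
  ... | _ , t-rest | refl with w <? value e
  ...   | yes w<e = (a , e) , here refl , a≤w , w<e
  ...   | no w≮e with tiles-sound e Is b t-rest (≮⇒≥ w≮e) w<b
  ...     | I , I∈ , w∈I = I , there I∈ , w∈I

  allPairs-++⁻ : ∀ {R : Interval → Interval → Set} xs {ys} →
    AllPairs R (xs ++ ys) → AllPairs R xs × All (λ x → All (R x) ys) xs
  allPairs-++⁻ [] _ = [] , []
  allPairs-++⁻ (x ∷ xs) (px ∷ p) with allPairs-++⁻ xs p
  ... | pxs , cross = All.++⁻ˡ xs px ∷ pxs , All.++⁻ʳ xs px ∷ cross

  pairwiseDisjoint-sound : ∀ Is → T (pairwiseDisjoint Is) → AllPairs (λ I J → T (disjoint I J)) Is
  pairwiseDisjoint-sound [] _ = []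
  pairwiseDisjoint-sound (I ∷ Is) t with Equivalence.to T-∧ t
  ... | tI , tIs = all⁺ (disjoint I) Is tI ∷ pairwiseDisjoint-sound Is tIs

  any-≟ᴵ-sound : ∀ I Is → T (any (I ≟ᴵ_) Is) → I ∈ Is
  any-≟ᴵ-sound I Is t = Any.map (λ {J} → ≟ᴵ-sound I J) (any⁻ (I ≟ᴵ_) Is t)

  ∈-concat⁻ : ∀ Is {w} → All (T ∘ nonempty) Is → w ∈ concatMap elements Is → Σ Interval λ I → I ∈ Is × w ∈ᴵ I
  ∈-concat⁻ (I ∷ Is) (neI ∷ ne) w∈ with ∈-++⁻ (elements I) w∈
  ... | inj₁ w∈I = I , here refl , ∈-elements⁻ I neI w∈I
  ... | inj₂ w∈Is with ∈-concat⁻ Is ne w∈Is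
  ...   | J , J∈ , w∈J = J , there J∈ , w∈J

  ∈-concat⁺ : ∀ Is {w I} → All (T ∘ nonempty) Is → I ∈ Is → w ∈ᴵ I → w ∈ concatMap elements Is
  ∈-concat⁺ (I ∷ Is) (neI ∷ _) (here refl) w∈I = ∈-++⁺ˡ (∈-elements⁺ I neI w∈I)
  ∈-concat⁺ (J ∷ Is) (_ ∷ ne) (there I∈) w∈I = ∈-++⁺ʳ (elements J) (∈-concat⁺ Is ne I∈ w∈I)

  concat-unique : ∀ Is → All (T ∘ nonempty) Is → AllPairs (λ I J → T (disjoint I J)) Is → Unique (concatMap elements Is)
  concat-unique [] _ _ = []
  concat-unique (I ∷ Is) (neI ∷ ne) (dI ∷ dIs) = ++⁺ (range-unique _ _) (concat-unique Is ne dIs) apart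
    where
    apart : ∀ {w} → w ∈ elements I × w ∈ concatMap elements Is → ⊥
    apart (w∈I , w∈Is) with ∈-concat⁻ Is ne w∈Is
    ... | J , J∈ , w∈J = disjoint-sound I J (All.lookup dI J∈) (∈-elements⁻ I neI w∈I) w∈J

  -- The intervals Is (of a cycle) and Rs (of the removed vertices) partition [0, value top),
  -- as certified by the tiling Ts.
  record Layout (Is Rs Ts : List Interval) (top : Point) : Set where
    field
      nonempties : T (all nonempty (Is ++ Rs))
      disjoints  : T (pairwiseDisjoint (Is ++ Rs))
      tiling     : T (tiles (low 0) Ts top)
      tiles-used : T (all (λ J → any (J ≟ᴵ_) (Is ++ Rs)) Ts)
      below-top  : T (all (λ I → proj₂ I ≤ᵖ top) Is)

  module _ {Is Rs Ts top} (L : Layout Is Rs Ts top) where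
    open Layout L

    nonempty-all : All (T ∘ nonempty) Is
    nonempty-all = All.++⁻ˡ Is (all⁺ nonempty (Is ++ Rs) nonempties)

    disjoint-all : AllPairs (λ I J → T (disjoint I J)) (Is ++ Rs)
    disjoint-all = pairwiseDisjoint-sound (Is ++ Rs) disjoints

    layout-unique : Unique (concatMap elements Is)
    layout-unique = concat-unique Is nonempty-all (proj₁ (allPairs-++⁻ Is disjoint-all))

    layout-sound : ∀ {w} → w ∈ concatMap elements Is → w < value top × (∀ R → R ∈ Rs → ¬ w ∈ᴵ R)
    layout-sound w∈ with ∈-concat⁻ Is nonempty-all w∈
    ... | I , I∈ , w∈I =
      <-≤-trans (proj₂ w∈I) (≤ᵖ-sound (proj₂ I) top (All.lookup (all⁺ (λ I → proj₂ I ≤ᵖ top) Is below-top) I∈)) ,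
      λ R R∈ w∈R → disjoint-sound I R (All.lookup (All.lookup (proj₂ (allPairs-++⁻ Is disjoint-all)) I∈) R∈) w∈I w∈R

    layout-complete : ∀ {w} → w < value top → (∀ R → R ∈ Rs → ¬ w ∈ᴵ R) → w ∈ concatMap elements Is
    layout-complete w< w∉Rs with tiles-sound (low 0) Ts top tiling z≤n w<
    ... | J , J∈ , w∈J with ∈-++⁻ Is (any-≟ᴵ-sound J (Is ++ Rs) (All.lookup (all⁺ (λ J → any (J ≟ᴵ_) (Is ++ Rs)) Ts tiles-used) J∈))
    ...   | inj₁ J∈Is = ∈-concat⁺ Is nonempty-all J∈Is w∈J
    ...   | inj₂ J∈Rs = ⊥-elim (w∉Rs J J∈Rs w∈J)

module Construction (d : ℕ) (d%3≡0 : d % 3 ≡ 0) where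

  open import Data.Nat
  open import Data.Nat.Properties
  open import Data.Nat.DivMod
  open import Data.Nat.Divisibility using (m%n≡0⇒n∣m)
  open import Data.Nat.GeneralisedArithmetic using (fold; iterate)
  open import Data.Nat.Solver using (module +-*-Solver)
  open import Data.Bool using (Bool; T; _∨_)
  open import Data.Bool.Properties using (T-∨)
  open import Data.Bool.ListAction using (all; any)
  open import Data.Unit using (⊤; tt)
  open import Data.Fin using (toℕ; fromℕ<)
  open import Data.Fin.Properties using (toℕ<n; toℕ-injective; toℕ-fromℕ<)
  open import Data.List using (List; []; _∷_; _++_; length; concatMap)
  open import Data.List.Properties using (++-identityʳ)
  open import Data.List.Membership.Propositional using (_∈_)
  open import Data.List.Relation.Unary.Any using (here; there)
  open import Data.List.Relation.Unary.All using (All; []; _∷_)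
  open import Data.List.Relation.Unary.Unique.Propositional using (Unique)
  open import Data.List.Relation.Unary.AllPairs using ([]; _∷_)
  open import Data.List.Relation.Unary.All.Properties using (all⁺)
  open import Function.Base using (_∘_)
  open import Function.Bundles using (Equivalence)
  open import Data.Product using (Σ; _×_; _,_; proj₁; proj₂)
  open import Data.Sum using (_⊎_; inj₁; inj₂; swap; [_,_]′)
  open import Data.Empty using (⊥; ⊥-elim)
  open import Relation.Nullary using (¬_; Dec; yes; no; does)
  open import Relation.Nullary.Decidable using (_×-dec_; _⊎-dec_; True; toWitness; dec-true; dec-false)
  open import Relation.Binary.PropositionalEquality hiding ([_])
  open import Defs using (Hamiltonian; Hypohamiltonian; K2Hamiltonian; Connected; MaxDegree; edgeCount)
  open Indices
  open Residues
  open Sums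
  open Intervals d

  m : ℕ
  m = 6 + d

  n : ℕ
  n = 4 + m

  hub : ℕ → ℕ
  hub c = c + m

  centre : ℕ
  centre = 3 + m

  -- Each edge of the graph, oriented once: rim vertex x < m is followed by sucMod m x
  -- around the rim, is joined to the hub with index x % 3, and every hub to the centre.
  Arc : ℕ → ℕ → Set
  Arc x y = (x < m × y ≡ sucMod m x) ⊎ (x < m × y ≡ hub (x % 3)) ⊎ (m ≤ x × x < centre × y ≡ centre)

  pattern rimArc x<m y≡ = inj₁ (x<m , y≡)
  pattern spokeArc x<m y≡ = inj₂ (inj₁ (x<m , y≡))
  pattern centreArc m≤x x< y≡ = inj₂ (inj₂ (m≤x , x< , y≡))

  E : ℕ → ℕ → Set
  E x y = Arc x y ⊎ Arc y x

  Arc? : ∀ x y → Dec (Arc x y)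
  Arc? x y = (x <? m ×-dec y ≟ sucMod m x) ⊎-dec (x <? m ×-dec y ≟ hub (x % 3))
           ⊎-dec (m ≤? x ×-dec x <? centre ×-dec y ≟ centre)

  E? : ∀ x y → Dec (E x y)
  E? x y = Arc? x y ⊎-dec Arc? y x

  E-sym : ∀ {x y} → E x y → E y x
  E-sym = swap

  rim≢hub : ∀ {x} c → x < m → x ≢ hub c
  rim≢hub {x} c x<m x≡ = <⇒≱ x<m (subst (m ≤_) (sym x≡) (m≤n+m m c))

  Arc-irrefl : ∀ x → ¬ Arc x x
  Arc-irrefl x (rimArc x<m x≡) with sucMod-cases m x x<m
  ... | inj₁ (_ , e) = 1+n≢n (sym (trans x≡ e))
  ... | inj₂ (sx≡m , e) = 1≢m (trans (cong suc (sym (trans x≡ e))) sx≡m)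
    where
    1≢m : 1 ≢ m
    1≢m ()
  Arc-irrefl x (spokeArc x<m x≡) = rim≢hub (x % 3) x<m x≡
  Arc-irrefl x (centreArc _ x< x≡) = <-irrefl x≡ x<

  E-irrefl : ∀ x → ¬ E x x
  E-irrefl x (inj₁ a) = Arc-irrefl x a
  E-irrefl x (inj₂ a) = Arc-irrefl x a

  open Cycles E

  open GraphFromRelation n E E? E-sym E-irrefl public

  +d%3 : ∀ c → (c + d) % 3 ≡ c % 3
  +d%3 c = %-remove-+ʳ c (m%n≡0⇒n∣m d 3 d%3≡0)

  m%3≡0 : m % 3 ≡ 0
  m%3≡0 = +d%3 6

  0<m : 0 < m
  0<m = s≤s z≤n

  rim<n : ∀ {j} → j < m → j < n
  rim<n j<m = ≤-trans j<m (m≤n+m m 4)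

  hub<n : ∀ c → c < 3 → hub c < n
  hub<n c c<3 = ≤-trans (+-monoˡ-< m c<3) (n≤1+n centre)

  centre<n : centre < n
  centre<n = ≤-refl

  hub-injective : ∀ c c′ → hub c ≡ hub c′ → c ≡ c′
  hub-injective = +-cancelʳ-≡ m

  -- For closed a and b the implicit argument reduces to ⊤ and is filled in by eta.
  computed< : ∀ {a b} {t : True (a <? b)} → a < b
  computed< {t = t} = toWitness t

  sucMod≡suc : ∀ {x} → suc x < m → sucMod m x ≡ suc x
  sucMod≡suc {x} sx<m with sucMod-cases m x (<⇒≤ sx<m)
  ... | inj₁ (_ , e) = e
  ... | inj₂ (sx≡m , _) = ⊥-elim (<-irrefl sx≡m sx<m)

  sucMod%3 : ∀ {x} → x < m → sucMod m x % 3 ≡ σ (x % 3)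
  sucMod%3 {x} x<m with sucMod-cases m x x<m
  ... | inj₁ (_ , e) = trans (cong (_% 3) e) (suc%3 x)
  ... | inj₂ (sx≡m , e) = trans (cong (_% 3) e) (trans (sym m%3≡0) (trans (cong (_% 3) (sym sx≡m)) (suc%3 x)))

  sucMod≢predMod-rim : ∀ {j} → j < m → sucMod m j ≢ predMod m j
  sucMod≢predMod-rim {j} j<m = sucMod≢predMod m j (≤-trans (s≤s (s≤s (s≤s z≤n))) (m≤m+n 6 d)) j<m

  lastRim : ℕ
  lastRim = 5 + d

  sucMod-lastRim : sucMod m lastRim ≡ 0
  sucMod-lastRim with sucMod-cases m lastRim ≤-refl
  ... | inj₁ (m<m , _) = ⊥-elim (<-irrefl refl m<m)
  ... | inj₂ (_ , e) = e

  lastRim%3 : lastRim % 3 ≡ 2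
  lastRim%3 = +d%3 5

  -- Neighbourhoods

  E-next : ∀ {j} → j < m → E j (sucMod m j)
  E-next j<m = inj₁ (rimArc j<m refl)

  E-prev : ∀ {j} → j < m → E j (predMod m j)
  E-prev {j} j<m = inj₂ (rimArc (predMod< m j j<m) (sym (sucMod-predMod m j j<m)))

  E-rim : ∀ a → suc a < m → E a (suc a)
  E-rim a sa<m with sucMod-cases m a (<⇒≤ sa<m)
  ... | inj₁ (_ , e) = inj₁ (rimArc (<⇒≤ sa<m) (sym e))
  ... | inj₂ (sa≡m , _) = ⊥-elim (<-irrefl sa≡m sa<m)

  E-wrap : E lastRim 0
  E-wrap = subst (E lastRim) sucMod-lastRim (E-next ≤-refl)

  E-spoke : ∀ x → x < m → E x (hub (x % 3))
  E-spoke x x<m = inj₁ (spokeArc x<m refl)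

  E-spoke+d : ∀ c → c < 6 → E (c + d) (hub (c % 3))
  E-spoke+d c c<6 = subst (λ r → E (c + d) (hub r)) (+d%3 c) (E-spoke (c + d) (+-monoˡ-< d c<6))

  E-centre : ∀ c → c < 3 → E (hub c) centre
  E-centre c c<3 = inj₁ (centreArc (m≤n+m m c) (+-monoˡ-< m c<3) refl)

  rim-neighbour : ∀ {j z} → j < m → E j z → z ≡ sucMod m j ⊎ z ≡ predMod m j ⊎ z ≡ hub (j % 3)
  rim-neighbour j<m (inj₁ (rimArc _ e)) = inj₁ e
  rim-neighbour j<m (inj₁ (spokeArc _ e)) = inj₂ (inj₂ e)
  rim-neighbour j<m (inj₁ (centreArc m≤j _ _)) = ⊥-elim (<⇒≱ j<m m≤j)
  rim-neighbour {j} {z} j<m (inj₂ (rimArc z<m e)) = inj₂ (inj₁ (trans (sym (predMod-sucMod m z z<m)) (cong (predMod m) (sym e))))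
  rim-neighbour j<m (inj₂ (spokeArc _ e)) = ⊥-elim (rim≢hub _ j<m e)
  rim-neighbour j<m (inj₂ (centreArc _ _ e)) = ⊥-elim (rim≢hub 3 j<m e)

  hub-neighbour : ∀ {c z} → c < 3 → E (hub c) z → (z < m × z % 3 ≡ c) ⊎ z ≡ centre
  hub-neighbour {c} _ (inj₁ (rimArc c+m<m _)) = ⊥-elim (rim≢hub c c+m<m refl)
  hub-neighbour {c} _ (inj₁ (spokeArc c+m<m _)) = ⊥-elim (rim≢hub c c+m<m refl)
  hub-neighbour _ (inj₁ (centreArc _ _ e)) = inj₂ e
  hub-neighbour {c} {z} _ (inj₂ (rimArc z<m e)) = ⊥-elim (rim≢hub c (sucMod< m z z<m) (sym e))
  hub-neighbour {c} {z} _ (inj₂ (spokeArc z<m e)) = inj₁ (z<m , sym (hub-injective c (z % 3) e))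
  hub-neighbour {c} c<3 (inj₂ (centreArc _ _ e)) = ⊥-elim (<⇒≢ c<3 (hub-injective c 3 e))

  centre-neighbour : ∀ {z} → E centre z → Σ ℕ λ c → c < 3 × z ≡ hub c
  centre-neighbour (inj₁ (rimArc c<m _)) = ⊥-elim (rim≢hub 3 c<m refl)
  centre-neighbour (inj₁ (spokeArc c<m _)) = ⊥-elim (rim≢hub 3 c<m refl)
  centre-neighbour (inj₁ (centreArc _ c<c _)) = ⊥-elim (<-irrefl refl c<c)
  centre-neighbour {z} (inj₂ (rimArc z<m e)) = ⊥-elim (rim≢hub 3 (sucMod< m z z<m) (sym e))
  centre-neighbour {z} (inj₂ (spokeArc z<m e)) = ⊥-elim (<⇒≢ (m%n<n z 3) (sym (hub-injective 3 (z % 3) e)))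
  centre-neighbour {z} (inj₂ (centreArc m≤z z<c _)) =
    z ∸ m , +-cancelʳ-< m (z ∸ m) 3 (subst (_< centre) (sym (m∸n+n≡m m≤z)) z<c) , sym (m∸n+n≡m m≤z)

  -- The rotation automorphism

  ρ : ℕ → ℕ
  ρ x with x <? m
  ... | yes _ = sucMod m x
  ... | no _ = σ (x ∸ m) + m

  ρ⁻¹ : ℕ → ℕ
  ρ⁻¹ x with x <? m
  ... | yes _ = predMod m x
  ... | no _ = σ⁻¹ (x ∸ m) + m

  ρ-rim : ∀ {x} → x < m → ρ x ≡ sucMod m x
  ρ-rim {x} x<m with x <? m
  ... | yes _ = refl
  ... | no x≮m = ⊥-elim (x≮m x<m)

  ρ-above : ∀ k → ρ (k + m) ≡ σ k + m
  ρ-above k with k + m <? m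
  ... | yes k+m<m = ⊥-elim (<⇒≱ k+m<m (m≤n+m m k))
  ... | no _ = cong (λ j → σ j + m) (m+n∸n≡m k m)

  ρ⁻¹-rim : ∀ {x} → x < m → ρ⁻¹ x ≡ predMod m x
  ρ⁻¹-rim {x} x<m with x <? m
  ... | yes _ = refl
  ... | no x≮m = ⊥-elim (x≮m x<m)

  ρ⁻¹-above : ∀ k → ρ⁻¹ (k + m) ≡ σ⁻¹ k + m
  ρ⁻¹-above k with k + m <? m
  ... | yes k+m<m = ⊥-elim (<⇒≱ k+m<m (m≤n+m m k))
  ... | no _ = cong (λ j → σ⁻¹ j + m) (m+n∸n≡m k m)

  data RimOrAbove : ℕ → Set where
    rim   : ∀ {x} → x < m → RimOrAbove x
    above : ∀ k → RimOrAbove (k + m)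

  rimOrAbove : ∀ x → RimOrAbove x
  rimOrAbove x with x <? m
  ... | yes x<m = rim x<m
  ... | no x≮m = subst RimOrAbove (m∸n+n≡m (≮⇒≥ x≮m)) (above (x ∸ m))

  ρ⁻¹∘ρ : ∀ x → ρ⁻¹ (ρ x) ≡ x
  ρ⁻¹∘ρ x with rimOrAbove x
  ... | rim x<m = begin
    ρ⁻¹ (ρ x)             ≡⟨ cong ρ⁻¹ (ρ-rim x<m) ⟩
    ρ⁻¹ (sucMod m x)       ≡⟨ ρ⁻¹-rim (sucMod< m x x<m) ⟩
    predMod m (sucMod m x) ≡⟨ predMod-sucMod m x x<m ⟩
    x                      ∎
    where open ≡-Reasoning
  ... | above k = begin
    ρ⁻¹ (ρ (k + m))   ≡⟨ cong ρ⁻¹ (ρ-above k) ⟩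
    ρ⁻¹ (σ k + m)     ≡⟨ ρ⁻¹-above (σ k) ⟩
    σ⁻¹ (σ k) + m     ≡⟨ cong (_+ m) (σ⁻¹∘σ k) ⟩
    k + m             ∎
    where open ≡-Reasoning

  ρ∘ρ⁻¹ : ∀ x → ρ (ρ⁻¹ x) ≡ x
  ρ∘ρ⁻¹ x with rimOrAbove x
  ... | rim x<m = begin
    ρ (ρ⁻¹ x)              ≡⟨ cong ρ (ρ⁻¹-rim x<m) ⟩
    ρ (predMod m x)        ≡⟨ ρ-rim (predMod< m x x<m) ⟩
    sucMod m (predMod m x) ≡⟨ sucMod-predMod m x x<m ⟩
    x                      ∎
    where open ≡-Reasoning
  ... | above k = begin
    ρ (ρ⁻¹ (k + m))   ≡⟨ cong ρ (ρ⁻¹-above k) ⟩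
    ρ (σ⁻¹ k + m)     ≡⟨ ρ-above (σ⁻¹ k) ⟩
    σ (σ⁻¹ k) + m     ≡⟨ cong (_+ m) (σ∘σ⁻¹ k) ⟩
    k + m             ∎
    where open ≡-Reasoning

  ρ-<m : ∀ {x} → x < m → ρ x < m
  ρ-<m {x} x<m = subst (_< m) (sym (ρ-rim x<m)) (sucMod< m x x<m)

  ρ⁻¹-<m : ∀ {x} → x < m → ρ⁻¹ x < m
  ρ⁻¹-<m {x} x<m = subst (_< m) (sym (ρ⁻¹-rim x<m)) (predMod< m x x<m)

  ρ-<n : ∀ {x} → x < n → ρ x < n
  ρ-<n {x} x<n with rimOrAbove x
  ... | rim x<m = ≤-trans (ρ-<m x<m) (m≤n+m m 4)
  ... | above k = subst (_< n) (sym (ρ-above k)) (+-monoˡ-< m (σ-<4 (+-cancelʳ-< m k 4 x<n)))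

  ρ⁻¹-<n : ∀ {x} → x < n → ρ⁻¹ x < n
  ρ⁻¹-<n {x} x<n with rimOrAbove x
  ... | rim x<m = ≤-trans (ρ⁻¹-<m x<m) (m≤n+m m 4)
  ... | above k = subst (_< n) (sym (ρ⁻¹-above k)) (+-monoˡ-< m (σ⁻¹-<4 (+-cancelʳ-< m k 4 x<n)))

  Arc-ρ : ∀ {x y} → Arc x y → Arc (ρ x) (ρ y)
  Arc-ρ {x} (rimArc x<m refl) rewrite ρ-rim x<m | ρ-rim (sucMod< m x x<m) = rimArc (sucMod< m x x<m) refl
  Arc-ρ {x} (spokeArc x<m refl) rewrite ρ-rim x<m | ρ-above (x % 3) =
    spokeArc (sucMod< m x x<m) (cong hub (sym (sucMod%3 x<m)))
  Arc-ρ {x} (centreArc m≤x x<c refl) with rimOrAbove x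
  ... | rim x<m = ⊥-elim (<⇒≱ x<m m≤x)
  ... | above k rewrite ρ-above k | ρ-above 3 =
    centreArc (m≤n+m m (σ k)) (+-monoˡ-< m (σ-<3 (+-cancelʳ-< m k 3 x<c))) refl

  E-ρ : ∀ {x y} → E x y → E (ρ x) (ρ y)
  E-ρ (inj₁ a) = inj₁ (Arc-ρ a)
  E-ρ (inj₂ a) = inj₂ (Arc-ρ a)

  -- Powers: fold x ρ t = ρᵗ x and iterate ρ⁻¹ x t = ρ⁻ᵗ x.
  open AutomorphismPower ρ ρ⁻¹ ρ⁻¹∘ρ ρ∘ρ⁻¹ E-ρ

  ρ^-<n : ∀ t {x} → x < n → fold x ρ t < n
  ρ^-<n zero x<n = x<n
  ρ^-<n (suc t) x<n = ρ-<n (ρ^-<n t x<n)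

  ρ⁻^-<n : ∀ t {x} → x < n → iterate ρ⁻¹ x t < n
  ρ⁻^-<n zero x<n = x<n
  ρ⁻^-<n (suc t) x<n = ρ⁻^-<n t (ρ⁻¹-<n x<n)

  ρ^-shift : ∀ t x → fold (ρ x) ρ t ≡ ρ (fold x ρ t)
  ρ^-shift zero x = refl
  ρ^-shift (suc t) x = cong ρ (ρ^-shift t x)

  ρ^-along-rim : ∀ t {x} → t + x < m → fold x ρ t ≡ t + x
  ρ^-along-rim zero _ = refl
  ρ^-along-rim (suc t) {x} st+x<m = trans (cong ρ (ρ^-along-rim t t+x<m)) (trans (ρ-rim t+x<m) (sucMod≡suc st+x<m))
    where t+x<m = <⇒≤ st+x<m

  ρ^-rim : ∀ t → t < m → fold 0 ρ t ≡ t
  ρ^-rim t t<m = trans (ρ^-along-rim t (subst (_< m) (sym (+-identityʳ t)) t<m)) (+-identityʳ t)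

  ρ^-rim-next : ∀ t → t < m → fold 1 ρ t ≡ sucMod m t
  ρ^-rim-next t t<m = begin
    fold 1 ρ t       ≡⟨ cong (λ z → fold z ρ t) (sym (trans (ρ-rim {0} computed<) (sucMod≡suc computed<))) ⟩
    fold (ρ 0) ρ t   ≡⟨ ρ^-shift t 0 ⟩
    ρ (fold 0 ρ t)   ≡⟨ cong ρ (ρ^-rim t t<m) ⟩
    ρ t              ≡⟨ ρ-rim t<m ⟩
    sucMod m t       ∎
    where open ≡-Reasoning

  ρ^-hub : ∀ t → fold (hub 0) ρ t ≡ hub (t % 3)
  ρ^-hub zero = refl
  ρ^-hub (suc t) = trans (cong ρ (ρ^-hub t)) (trans (ρ-above (t % 3)) (cong hub (sym (suc%3 t))))

  ρ^-centre : ∀ t → fold centre ρ t ≡ centre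
  ρ^-centre zero = refl
  ρ^-centre (suc t) = trans (cong ρ (ρ^-centre t)) (ρ-above 3)

  Without : ℕ → ℕ → Set
  Without x w = w < n × w ≢ x

  Without₂ : ℕ → ℕ → ℕ → Set
  Without₂ x y w = w < n × w ≢ x × w ≢ y

  rotate : ∀ t {x} → CycleOn (Without x) → CycleOn (Without (fold x ρ t))
  rotate t {x} C = CycleOn-resp to from (Power.map-cycle t C)
    where
    to : ∀ w → Without x (iterate ρ⁻¹ w t) → Without (fold x ρ t) w
    to w (w<n , w≢x) = subst (_< n) (fold-iterate t w) (ρ^-<n t w<n) ,
                       λ w≡ → w≢x (trans (cong (λ z → iterate ρ⁻¹ z t) w≡) (iterate-fold t x))
    from : ∀ w → Without (fold x ρ t) w → Without x (iterate ρ⁻¹ w t)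
    from w (w<n , w≢) = ρ⁻^-<n t w<n , λ w≡x → w≢ (trans (sym (fold-iterate t w)) (cong (λ z → fold z ρ t) w≡x))

  rotate₂ : ∀ t {x y} → CycleOn (Without₂ x y) → CycleOn (Without₂ (fold x ρ t) (fold y ρ t))
  rotate₂ t {x} {y} C = CycleOn-resp to from (Power.map-cycle t C)
    where
    to : ∀ w → Without₂ x y (iterate ρ⁻¹ w t) → Without₂ (fold x ρ t) (fold y ρ t) w
    to w (w<n , w≢x , w≢y) = subst (_< n) (fold-iterate t w) (ρ^-<n t w<n) ,
                             (λ w≡ → w≢x (trans (cong (λ z → iterate ρ⁻¹ z t) w≡) (iterate-fold t x))) ,
                             (λ w≡ → w≢y (trans (cong (λ z → iterate ρ⁻¹ z t) w≡) (iterate-fold t y)))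
    from : ∀ w → Without₂ (fold x ρ t) (fold y ρ t) w → Without₂ x y (iterate ρ⁻¹ w t)
    from w (w<n , w≢ , w≢′) = ρ⁻^-<n t w<n ,
                              (λ w≡x → w≢ (trans (sym (fold-iterate t w)) (cong (λ z → fold z ρ t) w≡x))) ,
                              (λ w≡y → w≢′ (trans (sym (fold-iterate t w)) (cong (λ z → fold z ρ t) w≡y)))

  swap₂ : ∀ {x y} → CycleOn (Without₂ x y) → CycleOn (Without₂ y x)
  swap₂ = CycleOn-resp (λ _ (w<n , w≢x , w≢y) → w<n , w≢y , w≢x) (λ _ (w<n , w≢y , w≢x) → w<n , w≢x , w≢y)

  -- Explicit cycles

  onRim : Interval → Bool
  onRim (s , e) = (e ≟ᵖ sucᵖ s) ∨ (e ≤ᵖ high 6)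

  Joined : List Interval → Set
  Joined (I ∷ J ∷ Is) = E (pred (value (proj₂ I))) (value (proj₁ J)) × Joined (J ∷ Is)
  Joined _ = ⊤

  lastInterval : Interval → List Interval → Interval
  lastInterval I [] = I
  lastInterval I (J ∷ Is) = lastInterval J Is

  range-walk : ∀ a l → a + suc l ≤ m → Walk (range a (suc l))
  range-walk a zero _ = single a
  range-walk a (suc l) a+l< = cons a (suc a) (range (suc (suc a)) l) (E-rim a sa<m)
    (range-walk (suc a) l (subst (_≤ m) (+-suc a (suc l)) a+l<))
    where
    sa<m : suc a < m
    sa<m = ≤-trans (s≤s (s≤s (m≤m+n a l))) (subst (_≤ m) (trans (+-suc a (suc l)) (cong suc (+-suc a l))) a+l<)

  lastOr-range : ∀ a l → lastOr a (range (suc a) l) ≡ a + l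
  lastOr-range a zero = sym (+-identityʳ a)
  lastOr-range a (suc l) = trans (lastOr-range (suc a) l) (sym (+-suc a l))

  interval-walk : ∀ I → T (nonempty I) → T (onRim I) → Σ (List ℕ) λ xs →
    elements I ≡ value (proj₁ I) ∷ xs × Walk (value (proj₁ I) ∷ xs) × lastOr (value (proj₁ I)) xs ≡ pred (value (proj₂ I))
  interval-walk (s , e) ne r with size s e in size≡ | size-sound s e (<ᵖ⇒≤ᵖ s e ne) | <ᵖ-sound s e ne
  ... | zero | s+0≡e | s<e = ⊥-elim (<-irrefl (trans (sym (+-identityʳ (value s))) s+0≡e) s<e)
  ... | suc l | s+l≡e | _ = range (suc (value s)) l , refl , walk , trans (lastOr-range (value s) l) (cong pred (sym e≡))
    where
    e≡ : value e ≡ suc (value s + l)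
    e≡ = trans (sym s+l≡e) (+-suc (value s) l)
    walk : Walk (range (value s) (suc l))
    walk with Equivalence.to T-∨ r
    ... | inj₂ e≤ = range-walk (value s) l (subst (_≤ m) (sym s+l≡e) (≤ᵖ-sound e (high 6) e≤))
    ... | inj₁ e≡s+1 = singleton (value s) l (suc-injective (trans (sym size≡) (trans (cong (size s) (≟ᵖ-sound e (sucᵖ s) e≡s+1)) (size-sucᵖ s))))
      where
      singleton : ∀ a l → l ≡ 0 → Walk (range a (suc l))
      singleton a zero _ = single a

  concat-walk : ∀ I Is → All (T ∘ nonempty) (I ∷ Is) → All (T ∘ onRim) (I ∷ Is) → Joined (I ∷ Is) →
    Σ (List ℕ) λ xs → concatMap elements (I ∷ Is) ≡ value (proj₁ I) ∷ xs × Walk (value (proj₁ I) ∷ xs)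
      × lastOr (value (proj₁ I)) xs ≡ pred (value (proj₂ (lastInterval I Is)))
  concat-walk I [] (neI ∷ []) (rI ∷ []) _ with interval-walk I neI rI
  ... | xs , e , w , l = xs , trans (++-identityʳ (elements I)) e , w , l
  concat-walk I (J ∷ Is) (neI ∷ ne) (rI ∷ r) (joint , joints) with interval-walk I neI rI | concat-walk J Is ne r joints
  ... | xs , e , w , l | ys , e′ , w′ , l′ =
    xs ++ value (proj₁ J) ∷ ys , cong₂ _++_ e e′ ,
    walk-++ _ xs _ ys w (subst (λ z → E z (value (proj₁ J))) (sym l) joint) w′ ,
    trans (lastOr-++ _ xs _ ys) l′

  -- A cycle through the values of the intervals I ∷ Is, in this order, which avoids exactly
  -- the intervals Rs.
  cycle-from-intervals : ∀ {P : ℕ → Set} Rs →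
    (∀ w → P w → w < n × (∀ R → R ∈ Rs → ¬ w ∈ᴵ R)) → (∀ w → w < n → (∀ R → R ∈ Rs → ¬ w ∈ᴵ R) → P w) →
    ∀ I Is Ts → Layout (I ∷ Is) Rs Ts (high 10) → T (all onRim (I ∷ Is)) → Joined (I ∷ Is) →
    E (pred (value (proj₂ (lastInterval I Is)))) (value (proj₁ I)) → 3 ≤ length (concatMap elements (I ∷ Is)) → CycleOn P
  cycle-from-intervals {P} Rs P⇒ ⇒P I Is Ts L r joints closing 3≤ with concat-walk I Is (nonempty-all L) (all⁺ onRim (I ∷ Is) r) joints
  ... | xs , e , w , l = record
    { start = value (proj₁ I)
    ; rest = xs
    ; walk = w
    ; closes = subst (λ z → E z (value (proj₁ I))) (sym l) closing
    ; long = ≤-pred (subst (λ zs → 3 ≤ length zs) e 3≤)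
    ; unique = subst Unique e (layout-unique L)
    ; sound = λ v v∈ → let (v< , v∉) = layout-sound L (subst (v ∈_) (sym e) v∈) in ⇒P v v< v∉
    ; complete = λ v p → let (v< , v∉) = P⇒ v p in subst (v ∈_) e (layout-complete L v< v∉)
    }

  point : Point → Interval
  point p = p , sucᵖ p

  ∈-point⁻ : ∀ {w} p → w ∈ᴵ point p → w ≡ value p
  ∈-point⁻ (low c) (c≤w , w<) = ≤-antisym (≤-pred w<) c≤w
  ∈-point⁻ (high c) (c≤w , w<) = ≤-antisym (≤-pred w<) c≤w

  ∈-point⁺ : ∀ p → value p ∈ᴵ point p
  ∈-point⁺ (low c) = ≤-refl , ≤-refl
  ∈-point⁺ (high c) = ≤-refl , ≤-refl

  cycle-without-point : ∀ p I Is Ts → Layout (I ∷ Is) (point p ∷ []) Ts (high 10) → T (all onRim (I ∷ Is)) → Joined (I ∷ Is) →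
    E (pred (value (proj₂ (lastInterval I Is)))) (value (proj₁ I)) → 3 ≤ length (concatMap elements (I ∷ Is)) →
    CycleOn (Without (value p))
  cycle-without-point p = cycle-from-intervals (point p ∷ [])
    (λ w (w<n , w≢p) → w<n , λ { R (here refl) w∈p → w≢p (∈-point⁻ p w∈p) })
    (λ w w<n w∉ → w<n , λ { refl → w∉ (point p) (here refl) (∈-point⁺ p) })

  cycle-without-points : ∀ p q I Is Ts → Layout (I ∷ Is) (point p ∷ point q ∷ []) Ts (high 10) → T (all onRim (I ∷ Is)) →
    Joined (I ∷ Is) → E (pred (value (proj₂ (lastInterval I Is)))) (value (proj₁ I)) →
    3 ≤ length (concatMap elements (I ∷ Is)) → CycleOn (Without₂ (value p) (value q))
  cycle-without-points p q = cycle-from-intervals (point p ∷ point q ∷ [])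
    (λ w (w<n , w≢p , w≢q) → w<n , λ { R (here refl) w∈p → w≢p (∈-point⁻ p w∈p)
                                    ; R (there (here refl)) w∈q → w≢q (∈-point⁻ q w∈q) })
    (λ w w<n w∉ → w<n , (λ { refl → w∉ (point p) (here refl) (∈-point⁺ p) })
                      , (λ { refl → w∉ (point q) (there (here refl)) (∈-point⁺ q) }))

  -- As for computed<, the Boolean checks are discharged by evaluation.
  -- In interval notation the hubs are high 6, high 7, high 8 and the centre is high 9.
  layout : ∀ {Is Rs Ts top} {t₁ : T (all nonempty (Is ++ Rs))} {t₂ : T (pairwiseDisjoint (Is ++ Rs))}
           {t₃ : T (tiles (low 0) Ts top)} {t₄ : T (all (λ J → any (J ≟ᴵ_) (Is ++ Rs)) Ts)}
           {t₅ : T (all (λ I → proj₂ I ≤ᵖ top) Is)} → Layout Is Rs Ts top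
  layout {t₁ = t₁} {t₂} {t₃} {t₄} {t₅} = record { nonempties = t₁ ; disjoints = t₂ ; tiling = t₃ ; tiles-used = t₄ ; below-top = t₅ }

  cycle-without-centre : CycleOn (Without centre)
  cycle-without-centre = cycle-without-point (high 9)
    (low 0 , low 2)
    ((high 7 , high 8) ∷ (high 4 , high 6) ∷ (high 8 , high 9) ∷ (low 2 , high 4) ∷ (high 6 , high 7) ∷ [])
    ((low 0 , low 2) ∷ (low 2 , high 4) ∷ (high 4 , high 6) ∷ (high 6 , high 7) ∷ (high 7 , high 8) ∷ (high 8 , high 9) ∷ (high 9 , high 10) ∷ [])
    layout tt
    (E-spoke 1 computed< , E-sym (E-spoke+d 4 computed<) , E-spoke+d 5 computed< , E-sym (E-spoke 2 computed<) , E-spoke+d 3 computed< , tt)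
    (E-sym (E-spoke 0 computed<))
    computed<

  cycle-without-hub₀ : CycleOn (Without (hub 0))
  cycle-without-hub₀ = cycle-without-point (high 6)
    (low 0 , high 5)
    ((high 7 , high 8) ∷ (high 9 , high 10) ∷ (high 8 , high 9) ∷ (high 5 , high 6) ∷ [])
    ((low 0 , high 5) ∷ (high 5 , high 6) ∷ (high 6 , high 7) ∷ (high 7 , high 8) ∷ (high 8 , high 9) ∷ (high 9 , high 10) ∷ [])
    layout tt
    (E-spoke+d 4 computed< , E-centre 1 computed< , E-sym (E-centre 2 computed<) , E-sym (E-spoke+d 5 computed<) , tt)
    E-wrap
    computed<

  cycle-without-rim₀ : CycleOn (Without 0)
  cycle-without-rim₀ = cycle-without-point (low 0)
    (low 1 , low 2)
    ((high 7 , high 8) ∷ (high 9 , high 10) ∷ (high 6 , high 7) ∷ (low 3 , high 6) ∷ (high 8 , high 9) ∷ (low 2 , low 3) ∷ [])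
    ((low 0 , low 1) ∷ (low 1 , low 2) ∷ (low 2 , low 3) ∷ (low 3 , high 6) ∷ (high 6 , high 7) ∷ (high 7 , high 8) ∷ (high 8 , high 9) ∷ (high 9 , high 10) ∷ [])
    layout tt
    (E-spoke 1 computed< , E-centre 1 computed< , E-sym (E-centre 0 computed<) , E-sym (E-spoke 3 computed<) , E-spoke+d 5 computed< , E-sym (E-spoke 2 computed<) , tt)
    (E-sym (E-rim 1 computed<))
    computed<

  cycle-without-hub₀-centre : CycleOn (Without₂ (hub 0) centre)
  cycle-without-hub₀-centre = cycle-without-points (high 6) (high 9)
    (low 0 , low 1)
    ((high 5 , high 6) ∷ (high 8 , high 9) ∷ (low 2 , high 5) ∷ (high 7 , high 8) ∷ (low 1 , low 2) ∷ [])
    ((low 0 , low 1) ∷ (low 1 , low 2) ∷ (low 2 , high 5) ∷ (high 5 , high 6) ∷ (high 6 , high 7) ∷ (high 7 , high 8) ∷ (high 8 , high 9) ∷ (high 9 , high 10) ∷ [])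
    layout tt
    (E-sym E-wrap , E-spoke+d 5 computed< , E-sym (E-spoke 2 computed<) , E-spoke+d 4 computed< , E-sym (E-spoke 1 computed<) , tt)
    (E-sym (E-rim 0 computed<))
    computed<

  cycle-without-rim₀-rim₁ : CycleOn (Without₂ 0 1)
  cycle-without-rim₀-rim₁ = cycle-without-points (low 0) (low 1)
    (high 6 , high 7)
    ((high 9 , high 10) ∷ (high 7 , high 8) ∷ (high 4 , high 6) ∷ (high 8 , high 9) ∷ (low 2 , high 4) ∷ [])
    ((low 0 , low 1) ∷ (low 1 , low 2) ∷ (low 2 , high 4) ∷ (high 4 , high 6) ∷ (high 6 , high 7) ∷ (high 7 , high 8) ∷ (high 8 , high 9) ∷ (high 9 , high 10) ∷ [])
    layout tt
    (E-centre 0 computed< , E-sym (E-centre 1 computed<) , E-sym (E-spoke+d 4 computed<) , E-spoke+d 5 computed< , E-sym (E-spoke 2 computed<) , tt)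
    (E-spoke+d 3 computed<)
    computed<

  cycle-without-rim₀-hub₀ : CycleOn (Without₂ 0 (hub 0))
  cycle-without-rim₀-hub₀ = cycle-without-points (low 0) (high 6)
    (low 1 , high 6)
    ((high 8 , high 9) ∷ (high 9 , high 10) ∷ (high 7 , high 8) ∷ [])
    ((low 0 , low 1) ∷ (low 1 , high 6) ∷ (high 6 , high 7) ∷ (high 7 , high 8) ∷ (high 8 , high 9) ∷ (high 9 , high 10) ∷ [])
    layout tt
    (E-spoke+d 5 computed< , E-centre 2 computed< , E-sym (E-centre 1 computed<) , tt)
    (E-sym (E-spoke 1 computed<))
    computed<

  -- Vertex- and edge-deleted subgraphs are hamiltonian

  hub%3 : ∀ {c} → c < 3 → hub (c % 3) ≡ hub c
  hub%3 c<3 = cong hub (m<n⇒m%n≡m c<3)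

  cycle-without-hub : ∀ c → c < 3 → CycleOn (Without (hub c))
  cycle-without-hub c c<3 = subst (CycleOn ∘ Without) (trans (ρ^-hub c) (hub%3 c<3)) (rotate c cycle-without-hub₀)

  cycle-without-vertex : ∀ x → x < n → CycleOn (Without x)
  cycle-without-vertex x x<n with rimOrAbove x
  ... | rim x<m = subst (CycleOn ∘ Without) (ρ^-rim x x<m) (rotate x cycle-without-rim₀)
  ... | above 0 = cycle-without-hub 0 computed<
  ... | above 1 = cycle-without-hub 1 computed<
  ... | above 2 = cycle-without-hub 2 computed<
  ... | above 3 = cycle-without-centre
  ... | above (suc (suc (suc (suc k)))) = ⊥-elim (<⇒≱ x<n (+-monoˡ-≤ m (m≤m+n 4 k)))

  cycle-without-edge : ∀ x y → E x y → CycleOn (Without₂ x y)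
  cycle-without-edge x y (inj₁ a) = cycle-without-arc x y a
    where
    cycle-without-arc : ∀ x y → Arc x y → CycleOn (Without₂ x y)
    cycle-without-arc x y (rimArc x<m refl) = subst₂ (λ a b → CycleOn (Without₂ a b)) (ρ^-rim x x<m) (ρ^-rim-next x x<m)
      (rotate₂ x cycle-without-rim₀-rim₁)
    cycle-without-arc x y (spokeArc x<m refl) = subst₂ (λ a b → CycleOn (Without₂ a b)) (ρ^-rim x x<m) (ρ^-hub x)
      (rotate₂ x cycle-without-rim₀-hub₀)
    cycle-without-arc x y (centreArc m≤x x<c refl) with rimOrAbove x
    ... | rim x<m = ⊥-elim (<⇒≱ x<m m≤x)
    ... | above c = subst₂ (λ a b → CycleOn (Without₂ a b)) (trans (ρ^-hub c) (hub%3 (+-cancelʳ-< m c 3 x<c))) (ρ^-centre c)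
      (rotate₂ c cycle-without-hub₀-centre)
  cycle-without-edge x y (inj₂ a) = swap₂ (cycle-without-edge y x (inj₁ a))

  without-vertex : ∀ v → Corresponds (λ w → ¬ w ≡ v) (Without (toℕ v))
  without-vertex v = record
    { to = λ w w≢v → toℕ<n w , λ e → w≢v (toℕ-injective e)
    ; from = λ w (_ , w≢v) e → w≢v (cong toℕ e)
    ; bounded = λ _ → proj₁ }

  without-edge : ∀ u v → Corresponds (λ w → ¬ w ≡ u × ¬ w ≡ v) (Without₂ (toℕ u) (toℕ v))
  without-edge u v = record
    { to = λ w (w≢u , w≢v) → toℕ<n w , (λ e → w≢u (toℕ-injective e)) , (λ e → w≢v (toℕ-injective e))
    ; from = λ w (_ , w≢u , w≢v) → (λ e → w≢u (cong toℕ e)) , (λ e → w≢v (cong toℕ e))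
    ; bounded = λ _ → proj₁ }

  k2-hamiltonian : K2Hamiltonian G
  k2-hamiltonian u v uv = toHamCycleOn (without-edge u v) (cycle-without-edge (toℕ u) (toℕ v) (Adj⇒R uv))

  -- The graph is not hamiltonian

  module OnHamiltonianCycle (H : CycleOn (_< n)) where
    open CycleOn H using (complete)
    open Successor H

    on-cycle : ∀ w → w < n → w ∈ vertices
    on-cycle = complete

    Uses⇒E : ∀ {a b} → a < n → Uses a b → E a b
    Uses⇒E {a} a<n (inj₁ refl) = R-next (on-cycle a a<n)
    Uses⇒E {a} a<n (inj₂ refl) = E-sym (R-prev (on-cycle a a<n))

    Uses-sym<n : ∀ {a b} → a < n → Uses a b → Uses b a
    Uses-sym<n {a} a<n = Uses-sym (on-cycle a a<n)

    rim-uses : ∀ {j z} → j < m → Uses j z → z ≡ sucMod m j ⊎ z ≡ predMod m j ⊎ z ≡ hub (j % 3)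
    rim-uses j<m u = rim-neighbour j<m (Uses⇒E (rim<n j<m) u)

    hub-uses : ∀ c {z} → c < 3 → Uses (hub c) z → (z < m × z % 3 ≡ c) ⊎ z ≡ centre
    hub-uses c c<3 u = hub-neighbour c<3 (Uses⇒E (hub<n c c<3) u)

    centre-uses : ∀ {z} → Uses centre z → Σ ℕ λ c → c < 3 × z ≡ hub c
    centre-uses u = centre-neighbour (Uses⇒E centre<n u)

    missing-next : ∀ {j} → j < m → ¬ Uses j (sucMod m j) → Uses j (predMod m j) × Uses j (hub (j % 3))
    missing-next {j} j<m = uses-other-two (on-cycle j (rim<n j<m)) (λ _ → rim-uses j<m)

    missing-prev : ∀ {j} → j < m → ¬ Uses j (predMod m j) → Uses j (sucMod m j) × Uses j (hub (j % 3))
    missing-prev {j} j<m = uses-other-two (on-cycle j (rim<n j<m)) among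
      where
      among : ∀ z → Uses j z → z ≡ predMod m j ⊎ z ≡ sucMod m j ⊎ z ≡ hub (j % 3)
      among z u with rim-uses j<m u
      ... | inj₁ e = inj₂ (inj₁ e)
      ... | inj₂ (inj₁ e) = inj₁ e
      ... | inj₂ (inj₂ e) = inj₂ (inj₂ e)

    both⇒no-spoke : ∀ {j} → j < m → Uses j (sucMod m j) → Uses j (predMod m j) → ¬ Uses j (hub (j % 3))
    both⇒no-spoke {j} j<m next prev spoke =
      [ (λ e → rim≢hub (j % 3) (sucMod< m j j<m) (sym e)) , (λ e → rim≢hub (j % 3) (predMod< m j j<m) (sym e)) ]′
      (uses-only-two (on-cycle j (rim<n j<m)) next prev (sucMod≢predMod-rim j<m) spoke)

    spoke-sym : ∀ {j} → j < m → Uses j (hub (j % 3)) → Uses (hub (j % 3)) j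
    spoke-sym j<m = Uses-sym<n (rim<n j<m)

    hub-saturated : ∀ {c a b} → c < 3 → a < m → b < m → a ≢ b → Uses (hub c) a → Uses (hub c) b → ¬ Uses (hub c) centre
    hub-saturated {c} c<3 a<m b<m a≢b ua ub uc =
      [ (λ e → rim≢hub 3 a<m (sym e)) , (λ e → rim≢hub 3 b<m (sym e)) ]′
      (uses-only-two (on-cycle (hub c) (hub<n c c<3)) ua ub a≢b uc)

    module NoWrap (¬wrap : ¬ Uses lastRim 0) where

      ¬last-next : ¬ Uses lastRim (sucMod m lastRim)
      ¬last-next u = ¬wrap (subst (Uses lastRim) sucMod-lastRim u)

      hub₂-uses-last : Uses (hub 2) lastRim
      hub₂-uses-last = subst (λ c → Uses (hub c) lastRim) lastRim%3 (spoke-sym ≤-refl (proj₂ (missing-next ≤-refl ¬last-next)))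

      ¬first-prev : ¬ Uses 0 (predMod m 0)
      ¬first-prev u = ¬wrap (Uses-sym<n (rim<n 0<m) u)

      -- y is the first rim vertex not using the rim edge to its successor.  The rim path
      -- 0, 1, …, y of the cycle can then only be left through the spokes at its two ends.
      module Prefix (y : ℕ) (0<y : 0 < y) (y≤last : y ≤ lastRim) (¬y-next : ¬ Uses y (sucMod m y))
                    (before : ∀ i → i < y → Uses i (sucMod m i)) where

        y<m : y < m
        y<m = s≤s y≤last

        before-suc : ∀ i → i < y → Uses i (suc i)
        before-suc i i<y = subst (Uses i) (sucMod≡suc (≤-<-trans i<y y<m)) (before i i<y)

        inner-prev : ∀ i → suc i ≤ y → Uses (suc i) i
        inner-prev i si≤y = Uses-sym<n (rim<n (<-trans (n<1+n i) (≤-<-trans si≤y y<m))) (before-suc i si≤y)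

        first-uses : Uses 0 1 × Uses 0 (hub 0)
        first-uses with missing-prev 0<m ¬first-prev
        ... | next , spoke = subst (Uses 0) (sucMod≡suc computed<) next , spoke

        hub₀-uses-first : Uses (hub 0) 0
        hub₀-uses-first = spoke-sym 0<m (proj₂ first-uses)

        y-uses : Uses y (predMod m y) × Uses y (hub (y % 3))
        y-uses = missing-next y<m ¬y-next

        hub-uses-y : ∀ {c} → y % 3 ≡ c → Uses (hub c) y
        hub-uses-y y%3≡c = subst (λ c → Uses (hub c) y) y%3≡c (spoke-sym y<m (proj₂ y-uses))

        spoke-users : ∀ j → j ≤ y → Uses j (hub (j % 3)) → j ≡ 0 ⊎ j ≡ y
        spoke-users zero _ _ = inj₁ refl
        spoke-users (suc i) si≤y spoke with m≤n⇒m<n∨m≡n si≤y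
        ... | inj₂ si≡y = inj₂ si≡y
        ... | inj₁ si<y = ⊥-elim (both⇒no-spoke (<-trans si<y y<m) (before (suc i) si<y) (inner-prev i (<⇒≤ si<y)) spoke)

        prefix-next : ∀ w → w ≤ y → next w ≤ y ⊎ next w ≡ hub 0 ⊎ next w ≡ hub (y % 3)
        prefix-next zero _ =
          [ (λ e → inj₁ (subst (_≤ y) (sym e) 0<y)) , (λ e → inj₂ (inj₁ e)) ]′
          (uses-only-two (on-cycle 0 (rim<n 0<m)) (proj₁ first-uses) (proj₂ first-uses) (rim≢hub 0 computed<) (inj₁ refl))
        prefix-next (suc i) si≤y with m≤n⇒m<n∨m≡n si≤y
        ... | inj₂ refl =
          [ (λ e → inj₁ (subst (_≤ y) (sym e) (n≤1+n i))) , (λ e → inj₂ (inj₂ e)) ]′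
          (uses-only-two (on-cycle y (rim<n y<m)) (proj₁ y-uses) (proj₂ y-uses) (rim≢hub (y % 3) (predMod< m y y<m)) (inj₁ refl))
        ... | inj₁ si<y =
          [ (λ e → inj₁ (subst (_≤ y) (sym e) si<y)) , (λ e → inj₁ (subst (_≤ y) (sym e) (≤-trans (n≤1+n i) si≤y))) ]′
          (uses-only-two (on-cycle (suc i) (rim<n (<-trans si<y y<m))) (before-suc (suc i) si<y) (inner-prev i si≤y) (λ ()) (inj₁ refl))

        after-uses : suc y < m → Uses (suc y) (sucMod m (suc y)) × Uses (suc y) (hub (suc y % 3))
        after-uses sy<m = missing-prev sy<m (λ u → ¬y-next (subst (Uses y) (sym (sucMod≡suc sy<m)) (Uses-sym<n (rim<n sy<m) u)))

        after≢last : suc y < m → suc y ≢ lastRim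
        after≢last sy<m refl = ¬last-next (proj₁ (after-uses sy<m))

        hub-uses-after : ∀ {c} → suc y < m → σ (y % 3) ≡ c → Uses (hub c) (suc y)
        hub-uses-after sy<m σ≡c = subst (λ c → Uses (hub c) (suc y)) (trans (suc%3 y) σ≡c) (spoke-sym sy<m (proj₂ (after-uses sy<m)))

        in-prefix≢hub : ∀ c {w} → w ≤ y → w ≢ hub c
        in-prefix≢hub c w≤y = rim≢hub c (≤-<-trans w≤y y<m)

        case0 : y % 3 ≡ 0 → ⊥
        case0 y%3≡0 = outside (next-closed S closed 0 (on-cycle 0 (rim<n 0<m)) (inj₁ z≤n) centre (on-cycle centre centre<n))
          where
          S : ℕ → Set
          S w = w ≤ y ⊎ w ≡ hub 0
          closed : ∀ w → w ∈ vertices → S w → S (next w)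
          closed w _ (inj₁ w≤y) = [ inj₁ , [ inj₂ , (λ e → inj₂ (trans e (cong hub y%3≡0))) ]′ ]′ (prefix-next w w≤y)
          closed _ _ (inj₂ refl) =
            [ (λ e → inj₁ (subst (_≤ y) (sym e) z≤n)) , (λ e → inj₁ (≤-reflexive e)) ]′
            (uses-only-two (on-cycle (hub 0) (hub<n 0 computed<)) hub₀-uses-first (hub-uses-y y%3≡0) (<⇒≢ 0<y) (inj₁ refl))
          outside : ¬ S centre
          outside (inj₁ c≤y) = in-prefix≢hub 3 c≤y refl
          outside (inj₂ e) = 0≢1+n (sym (hub-injective 3 0 e))

        case1 : y % 3 ≡ 1 → ⊥
        case1 y%3≡1 = outside (next-closed S closed 0 (on-cycle 0 (rim<n 0<m)) (inj₁ z≤n) (hub 2) (on-cycle (hub 2) (hub<n 2 computed<)))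
          where
          y≢last : y ≢ lastRim
          y≢last y≡last = 1≢2 (trans (sym y%3≡1) (trans (cong (_% 3) y≡last) lastRim%3))
            where
            1≢2 : 1 ≢ 2
            1≢2 ()
          sy<m : suc y < m
          sy<m = s≤s (≤∧≢⇒< y≤last y≢last)
          ¬hub₂-centre : ¬ Uses (hub 2) centre
          ¬hub₂-centre = hub-saturated {2} computed< sy<m ≤-refl (after≢last sy<m) (hub-uses-after sy<m (cong σ y%3≡1)) hub₂-uses-last
          centre-uses-hubs : Uses centre (hub 0) × Uses centre (hub 1)
          centre-uses-hubs = uses-other-two (on-cycle centre centre<n) among (λ u → ¬hub₂-centre (Uses-sym<n centre<n u))
            where
            among : ∀ z → Uses centre z → z ≡ hub 2 ⊎ z ≡ hub 0 ⊎ z ≡ hub 1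
            among z u with centre-uses u
            ... | 0 , _ , e = inj₂ (inj₁ e)
            ... | 1 , _ , e = inj₂ (inj₂ e)
            ... | 2 , _ , e = inj₁ e
            ... | suc (suc (suc _)) , s≤s (s≤s (s≤s ())) , _
          S : ℕ → Set
          S w = w ≤ y ⊎ w ≡ hub 0 ⊎ w ≡ hub 1 ⊎ w ≡ centre
          closed : ∀ w → w ∈ vertices → S w → S (next w)
          closed w _ (inj₁ w≤y) =
            [ inj₁ , [ (λ e → inj₂ (inj₁ e)) , (λ e → inj₂ (inj₂ (inj₁ (trans e (cong hub y%3≡1))))) ]′ ]′ (prefix-next w w≤y)
          closed _ _ (inj₂ (inj₁ refl)) =
            [ (λ e → inj₁ (subst (_≤ y) (sym e) z≤n)) , (λ e → inj₂ (inj₂ (inj₂ e))) ]′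
            (uses-only-two (on-cycle (hub 0) (hub<n 0 computed<)) hub₀-uses-first (Uses-sym<n centre<n (proj₁ centre-uses-hubs))
                           (rim≢hub 3 0<m) (inj₁ refl))
          closed _ _ (inj₂ (inj₂ (inj₁ refl))) =
            [ (λ e → inj₁ (≤-reflexive e)) , (λ e → inj₂ (inj₂ (inj₂ e))) ]′
            (uses-only-two (on-cycle (hub 1) (hub<n 1 computed<)) (hub-uses-y y%3≡1) (Uses-sym<n centre<n (proj₂ centre-uses-hubs))
                           (rim≢hub 3 y<m) (inj₁ refl))
          closed _ _ (inj₂ (inj₂ (inj₂ refl))) =
            [ (λ e → inj₂ (inj₁ e)) , (λ e → inj₂ (inj₂ (inj₁ e))) ]′
            (uses-only-two (on-cycle centre centre<n) (proj₁ centre-uses-hubs) (proj₂ centre-uses-hubs)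
                           (λ e → 0≢1+n (hub-injective 0 1 e)) (inj₁ refl))
          outside : ¬ S (hub 2)
          outside (inj₁ h≤y) = in-prefix≢hub 2 h≤y refl
          outside (inj₂ (inj₁ e)) = 0≢1+n (sym (hub-injective 2 0 e))
          outside (inj₂ (inj₂ (inj₁ e))) = 1≢2 (sym (hub-injective 2 1 e))
            where
            1≢2 : 1 ≢ 2
            1≢2 ()
          outside (inj₂ (inj₂ (inj₂ e))) = 1+n≢n (sym (suc-injective (hub-injective 2 3 e)))

        case2 : y % 3 ≡ 2 → ⊥
        case2 y%3≡2 with m≤n⇒m<n∨m≡n y≤last
        ... | inj₂ refl = uses-two (on-cycle (hub 1) (hub<n 1 computed<)) only-centre
          where
          only-centre : ∀ z → Uses (hub 1) z → z ≡ centre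
          only-centre z u with hub-uses 1 computed< u
          ... | inj₂ e = e
          ... | inj₁ (z<m , z%3≡1) with spoke-users z (≤-pred z<m) (subst (λ c → Uses z (hub c)) (sym z%3≡1) (Uses-sym<n (hub<n 1 computed<) u))
          ...   | inj₁ refl = ⊥-elim (0≢1+n z%3≡1)
          ...   | inj₂ refl = ⊥-elim (1+n≢n (sym (trans (sym z%3≡1) y%3≡2)))
        ... | inj₁ y<last = uses-two (on-cycle centre centre<n) only-hub₁
          where
          sy<m : suc y < m
          sy<m = s≤s y<last
          ¬hub₀-centre : ¬ Uses (hub 0) centre
          ¬hub₀-centre = hub-saturated {0} computed< 0<m sy<m (λ ()) hub₀-uses-first (hub-uses-after sy<m (cong σ y%3≡2))
          ¬hub₂-centre : ¬ Uses (hub 2) centre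
          ¬hub₂-centre = hub-saturated {2} computed< y<m ≤-refl (<⇒≢ y<last) (hub-uses-y y%3≡2) hub₂-uses-last
          only-hub₁ : ∀ z → Uses centre z → z ≡ hub 1
          only-hub₁ z u with centre-uses u
          ... | 0 , _ , refl = ⊥-elim (¬hub₀-centre (Uses-sym<n centre<n u))
          ... | 1 , _ , e = e
          ... | 2 , _ , refl = ⊥-elim (¬hub₂-centre (Uses-sym<n centre<n u))
          ... | suc (suc (suc _)) , s≤s (s≤s (s≤s ())) , _

        impossible : ⊥
        impossible with y % 3 in y%3 | m%n<n y 3
        ... | 0 | _ = case0 y%3
        ... | 1 | _ = case1 y%3
        ... | 2 | _ = case2 y%3
        ... | suc (suc (suc _)) | s≤s (s≤s (s≤s ()))

      impossible : ⊥
      impossible with first-failure (λ i → Uses? i (sucMod m i)) lastRim ¬last-next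
      ... | zero , _ , ¬0-next , _ = ¬first-prev (proj₁ (missing-next 0<m ¬0-next))
      ... | suc y , y≤last , ¬y-next , before = Prefix.impossible (suc y) (s≤s z≤n) y≤last ¬y-next before

    wrap-used : Uses lastRim 0
    wrap-used with Uses? lastRim 0
    ... | yes u = u
    ... | no ¬u = ⊥-elim (NoWrap.impossible ¬u)

  rotate-hamiltonian : ∀ t → CycleOn (_< n) → CycleOn (_< n)
  rotate-hamiltonian t H = CycleOn-resp (λ w w< → subst (_< n) (fold-iterate t w) (ρ^-<n t w<)) (λ w w< → ρ⁻^-<n t w<) (Power.map-cycle t H)

  -- Rotating the rim edge j j⁺ to the edge lastRim 0, which every Hamiltonian cycle uses.
  rim-used : ∀ H j → j < m → Successor.Uses H j (sucMod m j)
  rim-used H j j<m = Power.Uses-map⁻ t H (CycleOn.complete H j (rim<n j<m))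
    (subst₂ (Successor.Uses (rotate-hamiltonian t H)) to-last to-first (OnHamiltonianCycle.wrap-used (rotate-hamiltonian t H)))
    where
    t = lastRim ∸ j
    t+j≡last : t + j ≡ lastRim
    t+j≡last = m∸n+n≡m (≤-pred j<m)
    to-last : lastRim ≡ fold j ρ t
    to-last = sym (trans (ρ^-along-rim t (subst (_< m) (sym t+j≡last) ≤-refl)) t+j≡last)
    to-first : 0 ≡ fold (sucMod m j) ρ t
    to-first = begin
      0                      ≡⟨ sym sucMod-lastRim ⟩
      sucMod m lastRim       ≡⟨ sym (ρ-rim ≤-refl) ⟩
      ρ lastRim              ≡⟨ cong ρ to-last ⟩
      ρ (fold j ρ t)         ≡⟨ sym (ρ^-shift t j) ⟩
      fold (ρ j) ρ t         ≡⟨ cong (λ z → fold z ρ t) (ρ-rim j<m) ⟩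
      fold (sucMod m j) ρ t  ∎
      where open ≡-Reasoning

  -- Every rim vertex uses both of its rim edges, so the cycle never leaves the rim.
  no-hamiltonian-cycle : ¬ CycleOn (_< n)
  no-hamiltonian-cycle H = rim≢hub 3 (next-closed (_< m) closed 0 (on-cycle 0 (rim<n 0<m)) 0<m centre (on-cycle centre centre<n)) refl
    where
    open Successor H
    open OnHamiltonianCycle H using (on-cycle; Uses-sym<n)
    prev-used : ∀ w → w < m → Uses w (predMod m w)
    prev-used w w<m = Uses-sym<n (rim<n (predMod< m w w<m))
      (subst (Uses (predMod m w)) (sucMod-predMod m w w<m) (rim-used H (predMod m w) (predMod< m w w<m)))
    closed : ∀ w → w ∈ vertices → w < m → next w < m
    closed w _ w<m =
      [ (λ e → subst (_< m) (sym e) (sucMod< m w w<m)) , (λ e → subst (_< m) (sym e) (predMod< m w w<m)) ]′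
      (uses-only-two (on-cycle w (rim<n w<m)) (rim-used H w w<m) (prev-used w w<m)
                     (sucMod≢predMod-rim w<m) (inj₁ refl))

  not-hamiltonian : ¬ Hamiltonian G
  not-hamiltonian h = no-hamiltonian-cycle (fromHamCycleOn corresponds h)
    where
    corresponds : Corresponds (λ _ → ⊤) (_< n)
    corresponds = record { to = λ w _ → toℕ<n w ; from = λ _ _ → tt ; bounded = λ _ w<n → w<n }

  hypohamiltonian : Hypohamiltonian G
  hypohamiltonian = not-hamiltonian , λ v → toHamCycleOn (without-vertex v) (cycle-without-vertex (toℕ v) (toℕ<n v))

  -- Degrees and the number of edges

  count-by-list : ∀ (Q : ℕ → Set) (Q? : ∀ y → Dec (Q y)) ps → Unique ps → All (_< n) ps →
    (∀ y → Q y → y ∈ ps) → (∀ y → y ∈ ps → Q y) → sumRange (λ y → indicator (does (Q? y))) 0 n ≡ length ps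
  count-by-list Q Q? ps u ps<n complete sound =
    sumRange-indicator n (λ y → does (Q? y)) ps u ps<n (λ y t → complete y (does-true (Q? y) t)) (λ y y∈ → dec-true (Q? y) (sound y y∈))

  unique₃ : ∀ {a b c : ℕ} → a ≢ b → a ≢ c → b ≢ c → Unique (a ∷ b ∷ c ∷ [])
  unique₃ a≢b a≢c b≢c = (a≢b ∷ a≢c ∷ []) ∷ (b≢c ∷ []) ∷ [] ∷ []

  rim-degree : ∀ {j} → j < m → degreeℕ j ≡ 3
  rim-degree {j} j<m = count-by-list (E j) (E? j) (sucMod m j ∷ predMod m j ∷ hub (j % 3) ∷ [])
    (unique₃ (sucMod≢predMod-rim j<m) (rim≢hub _ (sucMod< m j j<m)) (rim≢hub _ (predMod< m j j<m)))
    (rim<n (sucMod< m j j<m) ∷ rim<n (predMod< m j j<m) ∷ hub<n (j % 3) (m%n<n j 3) ∷ [])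
    complete sound
    where
    complete : ∀ y → E j y → y ∈ sucMod m j ∷ predMod m j ∷ hub (j % 3) ∷ []
    complete y e = [ here , [ there ∘ here , there ∘ there ∘ here ]′ ]′ (rim-neighbour j<m e)
    sound : ∀ y → y ∈ sucMod m j ∷ predMod m j ∷ hub (j % 3) ∷ [] → E j y
    sound _ (here refl) = E-next j<m
    sound _ (there (here refl)) = E-prev j<m
    sound _ (there (there (here refl))) = E-spoke _ j<m

  centre-degree : degreeℕ centre ≡ 3
  centre-degree = count-by-list (E centre) (E? centre) (hub 0 ∷ hub 1 ∷ hub 2 ∷ [])
    (unique₃ (λ e → 0≢1+n (hub-injective 0 1 e)) (λ e → 0≢1+n (hub-injective 0 2 e)) (λ e → 1+n≢n (sym (suc-injective (hub-injective 1 2 e)))))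
    (hub<n 0 computed< ∷ hub<n 1 computed< ∷ hub<n 2 computed< ∷ [])
    complete sound
    where
    complete : ∀ y → E centre y → y ∈ hub 0 ∷ hub 1 ∷ hub 2 ∷ []
    complete y e with centre-neighbour e
    ... | 0 , _ , refl = here refl
    ... | 1 , _ , refl = there (here refl)
    ... | 2 , _ , refl = there (there (here refl))
    ... | suc (suc (suc _)) , s≤s (s≤s (s≤s ())) , _
    sound : ∀ y → y ∈ hub 0 ∷ hub 1 ∷ hub 2 ∷ [] → E centre y
    sound _ (here refl) = E-sym (E-centre 0 computed<)
    sound _ (there (here refl)) = E-sym (E-centre 1 computed<)
    sound _ (there (there (here refl))) = E-sym (E-centre 2 computed<)

  residues-from : ∀ {a} → a % 3 ≡ 0 → suc a % 3 ≡ 1 × suc (suc a) % 3 ≡ 2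
  residues-from {a} a%3≡0 = r₁ , trans (suc%3 (suc a)) (cong σ r₁)
    where r₁ = trans (suc%3 a) (cong σ a%3≡0)

  -- The recursive call uses that (3 + a) % 3 computes to a % 3.
  count-residue : ∀ K a c → c < 3 → a % 3 ≡ 0 → sumRange (λ y → δ (y % 3) c) a (K * 3) ≡ K
  count-residue zero a c _ _ = refl
  count-residue (suc K) a c c<3 a%3≡0 with residues-from {a} a%3≡0
  ... | r₁ , r₂ rewrite count-residue K (3 + a) c c<3 a%3≡0 | a%3≡0 | r₁ | r₂ = block c c<3
    where
    block : ∀ c → c < 3 → δ 0 c + (δ 1 c + (δ 2 c + K)) ≡ suc K
    block 0 _ = refl
    block 1 _ = refl
    block 2 _ = refl
    block (suc (suc (suc _))) (s≤s (s≤s (s≤s ())))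

  K : ℕ
  K = m / 3

  m≡K*3 : m ≡ K * 3
  m≡K*3 = trans (m≡m%n+[m/n]*n m 3) (cong (_+ K * 3) m%3≡0)

  hub-degree : ∀ c → c < 3 → degreeℕ (hub c) ≡ suc K
  hub-degree c c<3 = begin
    sumRange f 0 (4 + m)            ≡⟨ cong (sumRange f 0) (+-comm 4 m) ⟩
    sumRange f 0 (m + 4)            ≡⟨ sumRange-split f 0 m 4 ⟩
    sumRange f 0 m + sumRange f m 4 ≡⟨ cong₂ _+_ rim-part top-part ⟩
    K + 1                           ≡⟨ +-comm K 1 ⟩
    suc K                           ∎
    where
    open ≡-Reasoning
    f : ℕ → ℕ
    f y = indicator (does (E? (hub c) y))
    spoke-indicator : ∀ y → y < m → f y ≡ δ (y % 3) c
    spoke-indicator y y<m with y % 3 ≟ c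
    ... | yes e = cong indicator (dec-true (E? (hub c) y) (E-sym (subst (λ r → E y (hub r)) e (E-spoke _ y<m))))
    ... | no ≢c = cong indicator (dec-false (E? (hub c) y)
                    (λ e → [ (λ (_ , r) → ≢c r) , (λ e → rim≢hub 3 y<m e) ]′ (hub-neighbour c<3 e)))
    rim-part : sumRange f 0 m ≡ K
    rim-part = begin
      sumRange f 0 m                         ≡⟨ sumRange-cong 0 m (λ y _ y<m → spoke-indicator y y<m) ⟩
      sumRange (λ y → δ (y % 3) c) 0 m       ≡⟨ cong (sumRange (λ y → δ (y % 3) c) 0) m≡K*3 ⟩
      sumRange (λ y → δ (y % 3) c) 0 (K * 3) ≡⟨ count-residue K 0 c c<3 refl ⟩
      K                                      ∎
    not-hub : ∀ c′ → c′ < 3 → f (hub c′) ≡ 0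
    not-hub c′ c′<3 = cong indicator (dec-false (E? (hub c) (hub c′))
      (λ e → [ (λ (h<m , _) → rim≢hub c′ h<m refl) , (λ e → <⇒≢ c′<3 (hub-injective c′ 3 e)) ]′ (hub-neighbour c<3 e)))
    top-part : sumRange f m 4 ≡ 1
    top-part = cong₂ _+_ (not-hub 0 computed<) (cong₂ _+_ (not-hub 1 computed<) (cong₂ _+_ (not-hub 2 computed<)
                 (cong (_+ 0) (cong indicator (dec-true (E? (hub c) centre) (E-centre c c<3))))))

  max-degree : MaxDegree G (suc K)
  max-degree = (λ v → subst (_≤ suc K) (sym (degree≡degreeℕ v)) (bounded (toℕ v) (toℕ<n v)))
             , fromℕ< hub₀<n , trans (degree≡degreeℕ (fromℕ< hub₀<n)) (trans (cong degreeℕ (toℕ-fromℕ< hub₀<n)) (hub-degree 0 computed<))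
    where
    hub₀<n : hub 0 < n
    hub₀<n = hub<n 0 computed<
    3≤1+K : 3 ≤ suc K
    3≤1+K = s≤s (/-monoˡ-≤ 3 (m≤m+n 6 d))
    bounded : ∀ x → x < n → degreeℕ x ≤ suc K
    bounded x x<n with rimOrAbove x
    ... | rim x<m = subst (_≤ suc K) (sym (rim-degree x<m)) 3≤1+K
    ... | above 0 = ≤-reflexive (hub-degree 0 computed<)
    ... | above 1 = ≤-reflexive (hub-degree 1 computed<)
    ... | above 2 = ≤-reflexive (hub-degree 2 computed<)
    ... | above 3 = subst (_≤ suc K) (sym centre-degree) 3≤1+K
    ... | above (suc (suc (suc (suc k)))) = ⊥-elim (<⇒≱ x<n (+-monoˡ-≤ m (m≤m+n 4 k)))

  count-above : ∀ x ps → Unique ps → All (_< n) ps → (∀ y → E x y → x < y → y ∈ ps) → (∀ y → y ∈ ps → E x y × x < y) →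
    upDegreeℕ x ≡ length ps
  count-above x ps u ps<n complete sound =
    count-by-list (λ y → E x y × x < y) (λ y → E? x y ×-dec x <? y) ps u ps<n (λ y (e , x<y) → complete y e x<y) sound

  up-first : upDegreeℕ 0 ≡ 3
  up-first = count-above 0 (1 ∷ lastRim ∷ hub 0 ∷ []) (unique₃ (λ ()) (rim≢hub 0 computed<) (rim≢hub 0 ≤-refl))
    (rim<n computed< ∷ rim<n ≤-refl ∷ hub<n 0 computed< ∷ []) complete sound
    where
    complete : ∀ y → E 0 y → 0 < y → y ∈ 1 ∷ lastRim ∷ hub 0 ∷ []
    complete y e _ = [ here , [ there ∘ here , there ∘ there ∘ here ]′ ]′ (rim-neighbour 0<m e)
    sound : ∀ y → y ∈ 1 ∷ lastRim ∷ hub 0 ∷ [] → E 0 y × 0 < y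
    sound _ (here refl) = E-next 0<m , computed<
    sound _ (there (here refl)) = E-prev 0<m , s≤s z≤n
    sound _ (there (there (here refl))) = E-spoke _ 0<m , 0<m

  up-inner : ∀ {x} → 0 < x → suc x < m → upDegreeℕ x ≡ 2
  up-inner {suc x} _ ssx<m = count-above (suc x) (suc (suc x) ∷ hub (suc x % 3) ∷ []) ((rim≢hub _ ssx<m ∷ []) ∷ [] ∷ [])
    (rim<n ssx<m ∷ hub<n (suc x % 3) (m%n<n (suc x) 3) ∷ []) complete sound
    where
    sx<m = <⇒≤ ssx<m
    complete : ∀ y → E (suc x) y → suc x < y → y ∈ suc (suc x) ∷ hub (suc x % 3) ∷ []
    complete y e sx<y with rim-neighbour sx<m e
    ... | inj₁ e′ = here (trans e′ (sucMod≡suc ssx<m))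
    ... | inj₂ (inj₁ refl) = ⊥-elim (<-asym sx<y (n<1+n x))
    ... | inj₂ (inj₂ e′) = there (here e′)
    sound : ∀ y → y ∈ suc (suc x) ∷ hub (suc x % 3) ∷ [] → E (suc x) y × suc x < y
    sound _ (here refl) = subst (E (suc x)) (sucMod≡suc ssx<m) (E-next sx<m) , ≤-refl
    sound _ (there (here refl)) = E-spoke _ sx<m , ≤-trans sx<m (m≤n+m m (suc x % 3))

  up-last : upDegreeℕ lastRim ≡ 1
  up-last = count-above lastRim (hub (lastRim % 3) ∷ []) ([] ∷ []) (hub<n (lastRim % 3) (m%n<n lastRim 3) ∷ []) complete sound
    where
    complete : ∀ y → E lastRim y → lastRim < y → y ∈ hub (lastRim % 3) ∷ []
    complete y e last<y with rim-neighbour ≤-refl e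
    ... | inj₁ e′ = ⊥-elim (<⇒≱ last<y (subst (_≤ lastRim) (sym (trans e′ sucMod-lastRim)) z≤n))
    ... | inj₂ (inj₁ refl) = ⊥-elim (<-asym last<y (n<1+n (4 + d)))
    ... | inj₂ (inj₂ e′) = here e′
    sound : ∀ y → y ∈ hub (lastRim % 3) ∷ [] → E lastRim y × lastRim < y
    sound _ (here refl) = E-spoke _ ≤-refl , ≤-trans ≤-refl (m≤n+m m (lastRim % 3))

  up-hub : ∀ c → c < 3 → upDegreeℕ (hub c) ≡ 1
  up-hub c c<3 = count-above (hub c) (centre ∷ []) ([] ∷ []) (centre<n ∷ []) complete sound
    where
    complete : ∀ y → E (hub c) y → hub c < y → y ∈ centre ∷ []
    complete y e hub<y with hub-neighbour c<3 e
    ... | inj₁ (y<m , _) = ⊥-elim (<-asym hub<y (≤-trans y<m (m≤n+m m c)))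
    ... | inj₂ e′ = here e′
    sound : ∀ y → y ∈ centre ∷ [] → E (hub c) y × hub c < y
    sound _ (here refl) = E-centre c c<3 , +-monoˡ-< m c<3

  up-centre : upDegreeℕ centre ≡ 0
  up-centre = count-above centre [] [] [] complete (λ _ ())
    where
    complete : ∀ y → E centre y → centre < y → y ∈ []
    complete y e centre<y with centre-neighbour e
    ... | c , c<3 , refl = ⊥-elim (<-asym centre<y (+-monoˡ-< m c<3))

  edge-total : sumRange upDegreeℕ 0 n ≡ 2 * n ∸ 5
  edge-total = begin
    upDegreeℕ 0 + sumRange upDegreeℕ 1 (5 + (4 + d))
      ≡⟨ cong (λ l → upDegreeℕ 0 + sumRange upDegreeℕ 1 l) (+-comm 5 (4 + d)) ⟩
    upDegreeℕ 0 + sumRange upDegreeℕ 1 ((4 + d) + 5)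
      ≡⟨ cong (upDegreeℕ 0 +_) (sumRange-split upDegreeℕ 1 (4 + d) 5) ⟩
    upDegreeℕ 0 + (sumRange upDegreeℕ 1 (4 + d) + sumRange upDegreeℕ lastRim 5)
      ≡⟨ cong₂ (λ a b → a + (b + sumRange upDegreeℕ lastRim 5)) up-first inner ⟩
    3 + ((4 + d) * 2 + sumRange upDegreeℕ lastRim 5)
      ≡⟨ cong (λ t → 3 + ((4 + d) * 2 + t)) tail ⟩
    3 + ((4 + d) * 2 + 4)
      ≡⟨ arithmetic d ⟩
    2 * n ∸ 5 ∎
    where
    open ≡-Reasoning
    inner : sumRange upDegreeℕ 1 (4 + d) ≡ (4 + d) * 2
    inner = sumRange-const upDegreeℕ 2 1 (4 + d) (λ x 0<x x<5+d → up-inner 0<x (s≤s x<5+d))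
    tail : sumRange upDegreeℕ lastRim 5 ≡ 4
    tail = cong₂ _+_ up-last (cong₂ _+_ (up-hub 0 computed<) (cong₂ _+_ (up-hub 1 computed<) (cong₂ _+_ (up-hub 2 computed<) (cong (_+ 0) up-centre))))
    -- The right-hand side 2 * n ∸ 5 computes to 5 + (d + ((10 + d) + 0)).
    arithmetic : ∀ d → 3 + ((4 + d) * 2 + 4) ≡ 5 + (d + ((10 + d) + 0))
    arithmetic = solve 1 (λ k → con 3 :+ ((con 4 :+ k) :* con 2 :+ con 4) := con 5 :+ (k :+ ((con 10 :+ k) :+ con 0))) refl
      where open +-*-Solver

  edge-count : edgeCount G ≡ 2 * n ∸ 5
  edge-count = trans edgeCount≡ edge-total

  connected : Connected G
  connected = connected-through centre (hub 0) (hub<n 0 computed<) (E-sym (E-centre 0 computed<)) cycle-without-centre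

theorem4 : (n : ℕ) → 10 ≤ n → n % 3 ≡ 1 →
  Σ (Graph n) λ G →
      Connected G
    × edgeCount G ≡ 2 * n ∸ 5
    × MaxDegree G ((n ∸ 1) / 3)
    × Hypohamiltonian G
    × K2Hamiltonian G
theorem4 n 10≤n n%3≡1 with n ∸ 10 | m+[n∸m]≡n 10≤n
... | d | refl = G , connected , edge-count , subst (MaxDegree G) (sym degree≡) max-degree , hypohamiltonian , k2-hamiltonian
  where
  open Residues using (σ⁻¹; σ⁻¹∘σ; suc%3)
  -- (10 + d) % 3 computes to suc d % 3.
  d%3≡0 : d % 3 ≡ 0
  d%3≡0 = trans (sym (σ⁻¹∘σ (d % 3))) (cong σ⁻¹ (trans (sym (suc%3 d)) n%3≡1))
  open Construction d d%3≡0 using (G; K; connected; edge-count; max-degree; hypohamiltonian; k2-hamiltonian)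
  degree≡ : (n ∸ 1) / 3 ≡ suc K
  degree≡ = m/n≡1+[m∸n]/n {9 + d} {3} (s≤s (s≤s (s≤s z≤n)))
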